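{- Let $K$ be a clique of size $16$ in $\Gamma_{\{ -2,0\}}$ and $W_K$ its stabilizer in $W$. Then $W_K$ acts transitively on $K$.
   Context: $\Lambda=\{a\in \mathbb{Z}^8+\langle(\tfrac12,\ldots,\tfrac12)\rangle : \sum_i a_i\in 2\mathbb{Z}\}$ is the $E_8$ lattice, $E=\{a\in\Lambda:\|a\|=\sqrt2\}$, and $W$ the Weyl group of $E_8$. $\Gamma_{\{ -2,0\}}$ is the graph on $E$ whose edges join distinct roots with dot product $-2$ or $0$; a clique is a set of roots with all pairwise dot products in $\{ -2,0\}$. -}

module Defs where

open import Data.Nat using (ℕ)
open import Data.Integer using (ℤ; +_; -_; _+_; _-_; _*_; _/_)
open import Data.Integer.Divisibility using (_∣_)
open import Data.Fin using (Fin)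
open import Data.Vec using (Vec; zipWith; map; foldr)
open import Data.Vec.Relation.Unary.All using (All)
open import Data.List using (List)
import Data.List as L
import Data.List.Relation.Unary.All as LAll
open import Data.Product using (Σ; ∃; _×_)
open import Data.Sum using (_⊎_)
open import Relation.Binary.PropositionalEquality using (_≡_; _≢_)

-- Encoding: a vector x ∈ ℚ^8 of the E8 lattice is represented by its
-- DOUBLED coordinates X = 2x ∈ ℤ^8 (all coordinates of x lie in ½ℤ).
V : Set
V = Vec ℤ 8

-- X ⊙ Y = (2x)·(2y) = 4 (x·y)
_⊙_ : V → V → ℤ
X ⊙ Y = foldr (λ _ → ℤ) _+_ (+ 0) (zipWith _*_ X Y)

Even Odd : ℤ → Set
Even z = + 2 ∣ z
Odd z = + 2 ∣ (z - + 1)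

sumV : V → ℤ
sumV = foldr (λ _ → ℤ) _+_ (+ 0)

-- x ∈ Λ  iff  (x ∈ ℤ^8, i.e. X all even, or x ∈ ℤ^8 + (½,…,½), i.e. X all odd)
--         and Σ xᵢ ∈ 2ℤ, i.e. Σ Xᵢ ∈ 4ℤ.
InΛ : V → Set
InΛ X = (All Even X ⊎ All Odd X) × (+ 4 ∣ sumV X)

-- x ∈ E  iff  x ∈ Λ and ‖x‖² = 2, i.e. X ⊙ X = 8.
IsRoot : V → Set
IsRoot X = InΛ X × (X ⊙ X ≡ + 8)

-- edge relation of Γ_{-2,0}: x·y ∈ {-2, 0}, i.e. X ⊙ Y ∈ {-8, 0}
Adj : V → V → Set
Adj X Y = (X ⊙ Y ≡ - (+ 8)) ⊎ (X ⊙ Y ≡ + 0)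

-- reflection in the root r: s_r(x) = x - (x·r) r  (r·r = 2).
-- Doubled: 2 s_r(x) = X - ((X ⊙ R)/4) R; the division is exact for x ∈ Λ.
reflect : V → V → V
reflect R X = zipWith _-_ X (map (λ c → ((X ⊙ R) / + 4) * c) R)

-- An element of the Weyl group W, given as a word in reflections s_{r}
-- with r ∈ E; the word [r₁,…,r_k] acts as s_{r₁} ∘ ⋯ ∘ s_{r_k}.
record WeylWord : Set where
  constructor word
  field
    roots : List V
    allRoots : LAll.All IsRoot roots

act : WeylWord → V → V
act w X = L.foldr reflect X (WeylWord.roots w)

IsClique16 : (Fin 16 → V) → Set
IsClique16 K = (∀ i → IsRoot (K i))
             × (∀ i j → K i ≡ K j → i ≡ j)
             × (∀ i j → i ≢ j → Adj (K i) (K j))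

Stabilizes : WeylWord → (Fin 16 → V) → Set
Stabilizes w K = (∀ i → ∃ λ j → act w (K i) ≡ K j)
               × (∀ j → ∃ λ i → act w (K i) ≡ K j)

-- A 16-clique K of Γ_{-2,0} consists of eight mutually orthogonal pairs ±r, the vertices of a
-- cross-polytope. In real coordinates B = ∑_{k∈K} k kᵀ satisfies
-- ‖B − 4I‖² = ‖Gram(K)‖² − 8 tr B + 128 ≤ 128 − 256 + 128 = 0, so B = 4I and ∑_{k∈K} (w·k)² = 4 w·w.
-- Hence a root w whose inner products with K are all even lies in K: otherwise at most one of
-- them (k = −w) is nonzero and the sum is at most 4 < 8. Since E8 is an integral lattice, s_x for
-- x ∈ K preserves this parity condition, which settles y = −x. For orthogonal x, y ∈ K write
-- x − y = p + q with p, q orthogonal roots and p·x = 1 (such a p is found by a search over the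
-- 240 roots); then s_p s_q maps x to y, and the parity condition survives because p·z ≡ q·z
-- (mod 2) for every z ∈ K.

module Submission where

open import Defs
open import Data.Nat as ℕ using (ℕ; zero; suc; z≤n; s≤s)
import Data.Nat.Properties as ℕ
import Data.Nat.Divisibility as ℕ
open import Data.Integer as ℤ using (ℤ; +_; -[1+_]; -_; _+_; _-_; _*_; _/_; _≤_; _<_; +≤+; -≤-)
import Data.Integer.Properties as ℤ
import Data.Integer.DivMod as ℤ
open import Data.Integer.Divisibility.Signed
  using (_∣_; divides; ∣ᵤ⇒∣; ∣⇒∣ᵤ; ∣m∣n⇒∣m+n; ∣m∣n⇒∣m-n; ∣n⇒∣m*n; *-monoˡ-∣; *-cancelʳ-∣)
open import Data.Integer.Tactic.RingSolver using (solve-∀)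
open import Data.Fin as Fin using (Fin; zero; suc)
import Data.Fin.Properties as Fin
open import Data.Vec as Vec using (Vec; []; _∷_; zipWith; map; foldr; lookup)
import Data.Vec.Properties as Vec
open import Data.Vec.Relation.Unary.All as VecAll using ([]; _∷_)
open import Data.List as List using (List; []; _∷_; cartesianProductWith)
import Data.List.Relation.Unary.All as All
import Data.List.Relation.Unary.All.Properties as All
open import Data.List.Relation.Unary.Any using (here; there)
open import Data.List.Relation.Unary.Any.Properties using (any⁻)
open import Data.List.Membership.Propositional using (_∈_; find)
open import Data.List.Membership.Propositional.Properties using (∈-cartesianProductWith⁺; ∈-filter⁻)
open import Data.Bool using (Bool; T; not; _∨_; _∧_; true; false; if_then_else_)
open import Data.Bool.ListAction using (all; any)
open import Data.Bool.Properties using (T-≡; T-∨; T-∧)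
open import Data.Product using (∃; _×_; _,_; proj₁; proj₂)
open import Data.Sum using (_⊎_; inj₁; inj₂; [_,_]′)
open import Data.Unit using (tt)
open import Data.Empty using (⊥-elim)
open import Function using (id; _∘_)
open import Function.Bundles using (Equivalence)
open import Relation.Nullary using (¬_; yes; no; does; ¬?; contradiction)
open import Relation.Nullary.Decidable
  using (Dec; isYes; _×-dec_; _⊎-dec_; toWitness; toWitnessFalse; fromWitness; dec-true; decidable-stable)
open import Relation.Binary.PropositionalEquality

open import Algebra.Properties.Semiring.Sum ℤ.+-*-semiring
  using (sum; sum-syntax; sum-cong-≗; sum-replicate-zero; ∑-distrib-+; ∑-comm; *-distribˡ-sum; *-distribʳ-sum)

private variable
  n : ℕ

infixl 6 _+ᵥ_ _-ᵥ_
infixr 7 _*ᵥ_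

-- _·_ and sumᵥ extend _⊙_ and sumV to all lengths; at length 8 they agree definitionally.
_·_ : Vec ℤ n → Vec ℤ n → ℤ
X · Y = foldr (λ _ → ℤ) _+_ (+ 0) (zipWith _*_ X Y)

_+ᵥ_ _-ᵥ_ : Vec ℤ n → Vec ℤ n → Vec ℤ n
X +ᵥ Y = zipWith _+_ X Y
X -ᵥ Y = zipWith _-_ X Y

_*ᵥ_ : ℤ → Vec ℤ n → Vec ℤ n
k *ᵥ X = map (k *_) X

-ᵥ_ : Vec ℤ n → Vec ℤ n
-ᵥ X = map (λ x → - x) X

·-comm : (X Y : Vec ℤ n) → X · Y ≡ Y · X
·-comm [] [] = refl
·-comm (x ∷ X) (y ∷ Y) = cong₂ _+_ (ℤ.*-comm x y) (·-comm X Y)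

·-distribʳ--ᵥ : (X Y Z : Vec ℤ n) → (X -ᵥ Y) · Z ≡ X · Z - Y · Z
·-distribʳ--ᵥ [] [] [] = refl
·-distribʳ--ᵥ (x ∷ X) (y ∷ Y) (z ∷ Z) rewrite ·-distribʳ--ᵥ X Y Z = ring x y z (X · Z) (Y · Z)
  where
  ring : ∀ x y z a b → (x - y) * z + (a - b) ≡ x * z + a - (y * z + b)
  ring = solve-∀

·-distribˡ--ᵥ : (X Y Z : Vec ℤ n) → X · (Y -ᵥ Z) ≡ X · Y - X · Z
·-distribˡ--ᵥ X Y Z = trans (·-comm X (Y -ᵥ Z)) (trans (·-distribʳ--ᵥ Y Z X) (cong₂ _-_ (·-comm Y X) (·-comm Z X)))

·-*ᵥˡ : ∀ k (X Y : Vec ℤ n) → (k *ᵥ X) · Y ≡ k * (X · Y)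
·-*ᵥˡ k [] [] = sym (ℤ.*-zeroʳ k)
·-*ᵥˡ k (x ∷ X) (y ∷ Y) rewrite ·-*ᵥˡ k X Y = ring k x y (X · Y)
  where
  ring : ∀ k x y a → k * x * y + k * a ≡ k * (x * y + a)
  ring = solve-∀

-ᵥ-norm : (X Y : Vec ℤ n) → (X -ᵥ Y) · (X -ᵥ Y) ≡ X · X - + 2 * (X · Y) + Y · Y
-ᵥ-norm [] [] = refl
-ᵥ-norm (x ∷ X) (y ∷ Y) rewrite -ᵥ-norm X Y = ring x y (X · X) (X · Y) (Y · Y)
  where
  ring : ∀ x y a b c → (x - y) * (x - y) + (a - + 2 * b + c) ≡ x * x + a - + 2 * (x * y + b) + (y * y + c)
  ring = solve-∀

+ᵥ-norm : (X Y : Vec ℤ n) → (X +ᵥ Y) · (X +ᵥ Y) ≡ X · X + + 2 * (X · Y) + Y · Y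
+ᵥ-norm [] [] = refl
+ᵥ-norm (x ∷ X) (y ∷ Y) rewrite +ᵥ-norm X Y = ring x y (X · X) (X · Y) (Y · Y)
  where
  ring : ∀ x y a b c → (x + y) * (x + y) + (a + + 2 * b + c) ≡ x * x + a + + 2 * (x * y + b) + (y * y + c)
  ring = solve-∀

·-as-∑ : (X Y : Vec ℤ n) → X · Y ≡ ∑[ i < n ] (lookup X i * lookup Y i)
·-as-∑ [] [] = refl
·-as-∑ (x ∷ X) (y ∷ Y) = cong (λ s → x * y + s) (·-as-∑ X Y)

i*i≥0 : ∀ i → + 0 ≤ i * i
i*i≥0 (+ n) = subst (+ 0 ≤_) (ℤ.pos-* n n) (+≤+ ℕ.z≤n)
i*i≥0 ℤ.-[1+ _ ] = +≤+ ℕ.z≤n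

i*i≡0⇒i≡0 : ∀ i → i * i ≡ + 0 → i ≡ + 0
i*i≡0⇒i≡0 i i²≡0 = [ id , id ]′ (ℤ.i*j≡0⇒i≡0∨j≡0 i i²≡0)

·-self-nonneg : (X : Vec ℤ n) → + 0 ≤ X · X
·-self-nonneg [] = ℤ.≤-refl
·-self-nonneg (x ∷ X) = ℤ.+-mono-≤ (i*i≥0 x) (·-self-nonneg X)

nonneg+nonneg≡0 : ∀ {i j} → + 0 ≤ i → + 0 ≤ j → i + j ≡ + 0 → i ≡ + 0 × j ≡ + 0
nonneg+nonneg≡0 {i} {j} 0≤i 0≤j i+j≡0 = i≡0 , trans (sym (ℤ.+-identityˡ j)) (subst (λ k → k + j ≡ + 0) i≡0 i+j≡0)
  where
  i≡0 : i ≡ + 0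
  i≡0 = ℤ.≤-antisym (subst₂ _≤_ (ℤ.+-identityʳ i) i+j≡0 (ℤ.+-monoʳ-≤ i 0≤j)) 0≤i

-ᵥ-norm≡0⇒≡ : (X Y : Vec ℤ n) → (X -ᵥ Y) · (X -ᵥ Y) ≡ + 0 → X ≡ Y
-ᵥ-norm≡0⇒≡ [] [] _ = refl
-ᵥ-norm≡0⇒≡ (x ∷ X) (y ∷ Y) eq =
  let (x-y²≡0 , rest≡0) = nonneg+nonneg≡0 (i*i≥0 (x - y)) (·-self-nonneg (X -ᵥ Y)) eq
  in cong₂ _∷_ (ℤ.i-j≡0⇒i≡j x y (i*i≡0⇒i≡0 (x - y) x-y²≡0)) (-ᵥ-norm≡0⇒≡ X Y rest≡0)

+ᵥ-norm≡0⇒≡-ᵥ : (X Y : Vec ℤ n) → (X +ᵥ Y) · (X +ᵥ Y) ≡ + 0 → Y ≡ -ᵥ X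
+ᵥ-norm≡0⇒≡-ᵥ [] [] _ = refl
+ᵥ-norm≡0⇒≡-ᵥ (x ∷ X) (y ∷ Y) eq =
  let (x+y²≡0 , rest≡0) = nonneg+nonneg≡0 (i*i≥0 (x + y)) (·-self-nonneg (X +ᵥ Y)) eq
  in cong₂ _∷_ (ℤ.i-j≡0⇒i≡j y (- x) (trans (ring x y) (i*i≡0⇒i≡0 (x + y) x+y²≡0))) (+ᵥ-norm≡0⇒≡-ᵥ X Y rest≡0)
  where
  ring : ∀ x y → y - - x ≡ x + y
  ring = solve-∀

module _ {c : ℤ} {X Y : Vec ℤ n} (X·X≡c : X · X ≡ c) (Y·Y≡c : Y · Y ≡ c) where

  ·≡norm⇒≡ : X · Y ≡ c → X ≡ Y
  ·≡norm⇒≡ X·Y≡c = -ᵥ-norm≡0⇒≡ X Y (trans (-ᵥ-norm X Y) expand)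
    where
    ring : ∀ c → c - + 2 * c + c ≡ + 0
    ring = solve-∀
    expand : X · X - + 2 * (X · Y) + Y · Y ≡ + 0
    expand rewrite X·X≡c | Y·Y≡c | X·Y≡c = ring c

  ·≡-norm⇒≡-ᵥ : X · Y ≡ - c → Y ≡ -ᵥ X
  ·≡-norm⇒≡-ᵥ X·Y≡-c = +ᵥ-norm≡0⇒≡-ᵥ X Y (trans (+ᵥ-norm X Y) expand)
    where
    ring : ∀ c → c + + 2 * - c + c ≡ + 0
    ring = solve-∀
    expand : X · X + + 2 * (X · Y) + Y · Y ≡ + 0
    expand rewrite X·X≡c | Y·Y≡c | X·Y≡-c = ring c

  ·-bounded : - c ≤ X · Y × X · Y ≤ c
  ·-bounded = ℤ.0≤i-j⇒j≤i (half (subst (+ 0 ≤_) (trans (+ᵥ-norm X Y) sum-expand) (·-self-nonneg (X +ᵥ Y))))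
            , ℤ.0≤i-j⇒j≤i (half (subst (+ 0 ≤_) (trans (-ᵥ-norm X Y) diff-expand) (·-self-nonneg (X -ᵥ Y))))
    where
    half : ∀ {i} → + 0 ≤ + 2 * i → + 0 ≤ i
    half {i} 0≤2i = ℤ.*-cancelˡ-≤-pos (+ 0) i (+ 2) (subst (_≤ + 2 * i) (sym (ℤ.*-zeroʳ (+ 2))) 0≤2i)
    sum-expand : X · X + + 2 * (X · Y) + Y · Y ≡ + 2 * (X · Y - - c)
    sum-expand rewrite X·X≡c | Y·Y≡c = ring (X · Y) c
      where
      ring : ∀ a c → c + + 2 * a + c ≡ + 2 * (a - - c)
      ring = solve-∀
    diff-expand : X · X - + 2 * (X · Y) + Y · Y ≡ + 2 * (c - X · Y)
    diff-expand rewrite X·X≡c | Y·Y≡c = ring (X · Y) c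
      where
      ring : ∀ a c → c - + 2 * a + c ≡ + 2 * (c - a)
      ring = solve-∀

∑-const : ∀ n k → ∑[ i < n ] k ≡ + n * k
∑-const zero k = sym (ℤ.*-zeroˡ k)
∑-const (suc n) k = trans (cong (λ s → k + s) (∑-const n k)) (ring (+ n) k)
  where
  ring : ∀ m k → k + m * k ≡ (+ 1 + m) * k
  ring = solve-∀

∑-mono-≤ : {f g : Fin n → ℤ} → (∀ i → f i ≤ g i) → sum f ≤ sum g
∑-mono-≤ {zero} _ = ℤ.≤-refl
∑-mono-≤ {suc n} f≤g = ℤ.+-mono-≤ (f≤g zero) (∑-mono-≤ (λ i → f≤g (suc i)))

∑-nonneg : {f : Fin n → ℤ} → (∀ i → + 0 ≤ f i) → + 0 ≤ sum f
∑-nonneg {n} {f} 0≤f = subst (_≤ sum f) (sum-replicate-zero n) (∑-mono-≤ {f = λ _ → + 0} 0≤f)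

∑-nonneg≤0⇒≡0 : {f : Fin n → ℤ} → (∀ i → + 0 ≤ f i) → sum f ≤ + 0 → ∀ i → f i ≡ + 0
∑-nonneg≤0⇒≡0 {suc n} {f} 0≤f ∑f≤0 = each
  where
  parts : f zero ≡ + 0 × ∑[ i < n ] f (suc i) ≡ + 0
  parts = nonneg+nonneg≡0 (0≤f zero) (∑-nonneg (λ i → 0≤f (suc i))) (ℤ.≤-antisym ∑f≤0 (∑-nonneg 0≤f))
  each : ∀ i → f i ≡ + 0
  each zero = proj₁ parts
  each (suc i) = ∑-nonneg≤0⇒≡0 (λ i → 0≤f (suc i)) (ℤ.≤-reflexive (proj₂ parts)) i

δ : Fin n → Fin n → ℤ
δ i j = if does (i Fin.≟ j) then + 1 else + 0

δ-diag : (i : Fin n) → δ i i ≡ + 1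
δ-diag i rewrite dec-true (i Fin.≟ i) refl = refl

∑-δ : (i : Fin n) (f : Fin n → ℤ) → ∑[ j < n ] (δ i j * f j) ≡ f i
∑-δ {suc n} zero f = begin
  + 1 * f zero + ∑[ j < n ] (+ 0 * f (suc j)) ≡⟨ cong₂ _+_ (ℤ.*-identityˡ (f zero)) (sum-cong-≗ (λ j → ℤ.*-zeroˡ (f (suc j)))) ⟩
  f zero + ∑[ j < n ] (+ 0)                  ≡⟨ cong (λ s → f zero + s) (sum-replicate-zero n) ⟩
  f zero + + 0                                ≡⟨ ℤ.+-identityʳ (f zero) ⟩
  f zero                                      ∎
  where open ≡-Reasoning
∑-δ {suc n} (suc i) f = trans (cong₂ _+_ (ℤ.*-zeroˡ (f zero)) (∑-δ i (λ j → f (suc j)))) (ℤ.+-identityˡ (f (suc i)))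

∑-single : (i : Fin n) {f : Fin n → ℤ} → (∀ j → j ≢ i → f j ≡ + 0) → sum f ≡ f i
∑-single i {f} f≡0 = trans (sum-cong-≗ δf≗f) (∑-δ i f)
  where
  δf≗f : ∀ j → f j ≡ δ i j * f j
  δf≗f j with i Fin.≟ j
  ... | yes _ = sym (ℤ.*-identityˡ (f j))
  ... | no i≢j = trans (f≡0 j (i≢j ∘ sym)) (sym (ℤ.*-zeroˡ (f j)))

∑-atMostOne : ∀ {a} {f : Fin n → ℤ} → + 0 ≤ a → (∀ i → f i ≡ + 0 ⊎ f i ≡ a) →
              (∀ i j → f i ≢ + 0 → f j ≢ + 0 → i ≡ j) → sum f ≤ a
∑-atMostOne {n} {a} {f} 0≤a values unique with Fin.any? (λ i → ¬? (f i ℤ.≟ + 0))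
... | yes (i , fi≢0) = subst (_≤ a) (sym (∑-single i others≡0)) (fi≤a (values i))
  where
  others≡0 : ∀ j → j ≢ i → f j ≡ + 0
  others≡0 j j≢i = decidable-stable (f j ℤ.≟ + 0) (λ fj≢0 → j≢i (unique j i fj≢0 fi≢0))
  fi≤a : f i ≡ + 0 ⊎ f i ≡ a → f i ≤ a
  fi≤a (inj₁ fi≡0) = contradiction fi≡0 fi≢0
  fi≤a (inj₂ fi≡a) = ℤ.≤-reflexive fi≡a
... | no none = subst (_≤ a) (sym (trans (sum-cong-≗ all≡0) (sum-replicate-zero n))) 0≤a
  where
  all≡0 : ∀ i → f i ≡ + 0
  all≡0 i = decidable-stable (f i ℤ.≟ + 0) (λ fi≢0 → none (i , fi≢0))

-- Cross-polytopes are tight frames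

bounded-multiple : ∀ {c a} .{{_ : ℤ.Positive c}} → c ∣ a → - c ≤ a → a ≤ c → a ≡ - c ⊎ a ≡ + 0 ⊎ a ≡ c
bounded-multiple {c} (divides q refl) -c≤qc qc≤c = values q
  (ℤ.*-cancelʳ-≤-pos -[1+ 0 ] q c (subst (_≤ q * c) (sym (ℤ.-1*i≡-i c)) -c≤qc))
  (ℤ.*-cancelʳ-≤-pos q (+ 1) c (subst (q * c ≤_) (sym (ℤ.*-identityˡ c)) qc≤c))
  where
  values : ∀ q → -[1+ 0 ] ≤ q → q ≤ + 1 → q * c ≡ - c ⊎ q * c ≡ + 0 ⊎ q * c ≡ c
  values -[1+ 0 ] _ _ = inj₁ (ℤ.-1*i≡-i c)
  values (+ 0) _ _ = inj₂ (inj₁ (ℤ.*-zeroˡ c))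
  values (+ 1) _ _ = inj₂ (inj₂ (ℤ.*-identityˡ c))
  values -[1+ suc _ ] (-≤- ()) _
  values (+ suc (suc _)) _ (+≤+ (ℕ.s≤s ()))

∑-*-∑ : ∀ {p q} (f : Fin p → ℤ) (g : Fin q → ℤ) → sum f * sum g ≡ ∑[ i < p ] ∑[ j < q ] (f i * g j)
∑-*-∑ f g = trans (*-distribʳ-sum (sum g) f) (sum-cong-≗ (λ i → *-distribˡ-sum (f i) g))

∑⁴-swap : ∀ {p q} (F : Fin q → Fin q → Fin p → Fin p → ℤ) →
          ∑[ i < q ] ∑[ j < q ] ∑[ m < p ] ∑[ n < p ] F i j m n ≡ ∑[ m < p ] ∑[ n < p ] ∑[ i < q ] ∑[ j < q ] F i j m n
∑⁴-swap {p} {q} F = begin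
  ∑[ i < q ] ∑[ j < q ] ∑[ m < p ] ∑[ n < p ] F i j m n ≡⟨ sum-cong-≗ (λ i → ∑-comm (λ j m → ∑[ n < p ] F i j m n)) ⟩
  ∑[ i < q ] ∑[ m < p ] ∑[ j < q ] ∑[ n < p ] F i j m n ≡⟨ ∑-comm (λ i m → ∑[ j < q ] ∑[ n < p ] F i j m n) ⟩
  ∑[ m < p ] ∑[ i < q ] ∑[ j < q ] ∑[ n < p ] F i j m n ≡⟨ sum-cong-≗ (λ m → sum-cong-≗ (λ i → ∑-comm (λ j n → F i j m n))) ⟩
  ∑[ m < p ] ∑[ i < q ] ∑[ n < p ] ∑[ j < q ] F i j m n ≡⟨ sum-cong-≗ (λ m → ∑-comm (λ i n → ∑[ j < q ] F i j m n)) ⟩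
  ∑[ m < p ] ∑[ n < p ] ∑[ i < q ] ∑[ j < q ] F i j m n ∎
  where open ≡-Reasoning

frobenius-AᵀA≡AAᵀ : ∀ {p q} (A : Fin p → Fin q → ℤ) →
  ∑[ i < q ] ∑[ j < q ] ((∑[ m < p ] (A m i * A m j)) * (∑[ m < p ] (A m i * A m j))) ≡
  ∑[ m < p ] ∑[ n < p ] ((∑[ i < q ] (A m i * A n i)) * (∑[ i < q ] (A m i * A n i)))
frobenius-AᵀA≡AAᵀ {p} {q} A = begin
  ∑[ i < q ] ∑[ j < q ] ((∑[ m < p ] (A m i * A m j)) * (∑[ n < p ] (A n i * A n j)))
    ≡⟨ sum-cong-≗ (λ i → sum-cong-≗ (λ j → ∑-*-∑ (λ m → A m i * A m j) (λ n → A n i * A n j))) ⟩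
  ∑[ i < q ] ∑[ j < q ] ∑[ m < p ] ∑[ n < p ] ((A m i * A m j) * (A n i * A n j))
    ≡⟨ ∑⁴-swap (λ i j m n → (A m i * A m j) * (A n i * A n j)) ⟩
  ∑[ m < p ] ∑[ n < p ] ∑[ i < q ] ∑[ j < q ] ((A m i * A m j) * (A n i * A n j))
    ≡⟨ sum-cong-≗ (λ m → sum-cong-≗ (λ n → sum-cong-≗ (λ i → sum-cong-≗ (λ j → ring (A m i) (A m j) (A n i) (A n j))))) ⟩
  ∑[ m < p ] ∑[ n < p ] ∑[ i < q ] ∑[ j < q ] ((A m i * A n i) * (A m j * A n j))
    ≡⟨ sum-cong-≗ (λ m → sum-cong-≗ (λ n → ∑-*-∑ (λ i → A m i * A n i) (λ j → A m j * A n j))) ⟨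
  ∑[ m < p ] ∑[ n < p ] ((∑[ i < q ] (A m i * A n i)) * (∑[ j < q ] (A m j * A n j))) ∎
  where
  open ≡-Reasoning
  ring : ∀ a b c d → (a * b) * (c * d) ≡ (a * c) * (b * d)
  ring = solve-∀

module CrossPolytope {d : ℕ} {c : ℤ} .{{_ : ℤ.Positive c}} (K : Fin (d ℕ.+ d) → Vec ℤ d)
  (norm : ∀ m → K m · K m ≡ c)
  (gram : ∀ m n → m ≢ n → K m · K n ≡ - c ⊎ K m · K n ≡ + 0)
  (injective : ∀ m n → K m ≡ K n → m ≡ n) where

  private
    N = d ℕ.+ d
    A : Fin N → Fin d → ℤ
    A m i = lookup (K m) i

  frameOperator : Fin d → Fin d → ℤ
  frameOperator i j = ∑[ m < N ] (A m i * A m j)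

  private
    B = frameOperator

  trace-frameOperator : ∑[ i < d ] B i i ≡ + N * c
  trace-frameOperator = begin
    ∑[ i < d ] ∑[ m < N ] (A m i * A m i) ≡⟨ ∑-comm (λ i m → A m i * A m i) ⟩
    ∑[ m < N ] ∑[ i < d ] (A m i * A m i) ≡⟨ sum-cong-≗ (λ m → trans (sym (·-as-∑ (K m) (K m))) (norm m)) ⟩
    ∑[ m < N ] c                          ≡⟨ ∑-const N c ⟩
    + N * c                               ∎
    where open ≡-Reasoning

  antipode-unique : ∀ {m n n′} → K n ≡ -ᵥ K m → K n′ ≡ -ᵥ K m → n ≡ n′
  antipode-unique Kn≡-Km Kn′≡-Km = injective _ _ (trans Kn≡-Km (sym Kn′≡-Km))

  row-bound : ∀ m → ∑[ n < N ] ((K m · K n) * (K m · K n)) ≤ + 2 * (c * c)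
  row-bound m = begin
    ∑[ n < N ] (G n * G n)                          ≡⟨ sum-cong-≗ (λ n → ring (G n * G n) (δ m n * (c * c))) ⟩
    ∑[ n < N ] (offDiag n + δ m n * (c * c))        ≡⟨ ∑-distrib-+ offDiag (λ n → δ m n * (c * c)) ⟩
    sum offDiag + ∑[ n < N ] (δ m n * (c * c))      ≡⟨ cong (λ s → sum offDiag + s) (∑-δ m (λ _ → c * c)) ⟩
    sum offDiag + c * c                             ≤⟨ ℤ.+-monoˡ-≤ (c * c) (∑-atMostOne (i*i≥0 c) offDiag-values offDiag-unique) ⟩
    c * c + c * c                                   ≡⟨ ring₂ (c * c) ⟩
    + 2 * (c * c)                                   ∎
    where
    open ℤ.≤-Reasoning
    ring : ∀ a b → a ≡ (a - b) + b
    ring = solve-∀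
    ring₂ : ∀ a → a + a ≡ + 2 * a
    ring₂ = solve-∀
    G : Fin N → ℤ
    G n = K m · K n
    offDiag : Fin N → ℤ
    offDiag n = G n * G n - δ m n * (c * c)
    diagonal : ∀ c → c * c - + 1 * (c * c) ≡ + 0
    diagonal = solve-∀
    antipodal : ∀ c → - c * - c - + 0 * (c * c) ≡ c * c
    antipodal = solve-∀
    offDiag-values : ∀ n → offDiag n ≡ + 0 ⊎ offDiag n ≡ c * c
    offDiag-values n with m Fin.≟ n
    ... | yes refl = inj₁ (trans (cong (λ g → g * g - + 1 * (c * c)) (norm m)) (diagonal c))
    ... | no m≢n with gram m n m≢n
    ...   | inj₁ G≡-c = inj₂ (trans (cong (λ g → g * g - + 0 * (c * c)) G≡-c) (antipodal c))
    ...   | inj₂ G≡0 = inj₁ (cong (λ g → g * g - + 0 * (c * c)) G≡0)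
    offDiag-antipode : ∀ n → offDiag n ≢ + 0 → K n ≡ -ᵥ K m
    offDiag-antipode n o≢0 with m Fin.≟ n
    ... | yes refl = contradiction (trans (cong (λ g → g * g - + 1 * (c * c)) (norm m)) (diagonal c)) o≢0
    ... | no m≢n with gram m n m≢n
    ...   | inj₁ G≡-c = ·≡-norm⇒≡-ᵥ (norm m) (norm n) G≡-c
    ...   | inj₂ G≡0 = contradiction (cong (λ g → g * g - + 0 * (c * c)) G≡0) o≢0
    offDiag-unique : ∀ n n′ → offDiag n ≢ + 0 → offDiag n′ ≢ + 0 → n ≡ n′
    offDiag-unique n n′ o≢0 o′≢0 = antipode-unique (offDiag-antipode n o≢0) (offDiag-antipode n′ o′≢0)

  private
    D : Fin d → Fin d → ℤ
    D i j = B i j - + 2 * c * δ i j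

    D-row : ∀ i → ∑[ j < d ] (D i j * D i j) ≡ ∑[ j < d ] (B i j * B i j) + (- (+ 4 * c) * B i i + + 4 * (c * c) * + 1)
    D-row i = begin
      ∑[ j < d ] (D i j * D i j)
        ≡⟨ sum-cong-≗ (λ j → ring c (B i j) (δ i j)) ⟩
      ∑[ j < d ] (B i j * B i j + (- (+ 4 * c) * (δ i j * B i j) + + 4 * (c * c) * (δ i j * δ i j)))
        ≡⟨ ∑-distrib-+ (λ j → B i j * B i j) _ ⟩
      ∑[ j < d ] (B i j * B i j) + ∑[ j < d ] (- (+ 4 * c) * (δ i j * B i j) + + 4 * (c * c) * (δ i j * δ i j))
        ≡⟨ cong (λ s → ∑[ j < d ] (B i j * B i j) + s) (∑-distrib-+ (λ j → - (+ 4 * c) * (δ i j * B i j)) _) ⟩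
      ∑[ j < d ] (B i j * B i j) + (∑[ j < d ] (- (+ 4 * c) * (δ i j * B i j)) + ∑[ j < d ] (+ 4 * (c * c) * (δ i j * δ i j)))
        ≡⟨ cong (λ s → ∑[ j < d ] (B i j * B i j) + s) (cong₂ _+_
             (trans (sym (*-distribˡ-sum (- (+ 4 * c)) (λ j → δ i j * B i j))) (cong (- (+ 4 * c) *_) (∑-δ i (B i))))
             (trans (sym (*-distribˡ-sum (+ 4 * (c * c)) (λ j → δ i j * δ i j))) (cong (+ 4 * (c * c) *_) (trans (∑-δ i (δ i)) (δ-diag i))))) ⟩
      ∑[ j < d ] (B i j * B i j) + (- (+ 4 * c) * B i i + + 4 * (c * c) * + 1) ∎
      where
      open ≡-Reasoning
      ring : ∀ c b e → (b - + 2 * c * e) * (b - + 2 * c * e) ≡ b * b + (- (+ 4 * c) * (e * b) + + 4 * (c * c) * (e * e))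
      ring = solve-∀

    -- ‖B − 2cI‖² = ‖Gram‖² − 4c tr B + 4c²d, and each row of the Gram matrix has at most two entries ±c.
    ∑∑D²≤0 : ∑[ i < d ] ∑[ j < d ] (D i j * D i j) ≤ + 0
    ∑∑D²≤0 = begin
      ∑[ i < d ] ∑[ j < d ] (D i j * D i j)
        ≡⟨ sum-cong-≗ D-row ⟩
      ∑[ i < d ] (∑[ j < d ] (B i j * B i j) + (- (+ 4 * c) * B i i + + 4 * (c * c) * + 1))
        ≡⟨ ∑-distrib-+ (λ i → ∑[ j < d ] (B i j * B i j)) _ ⟩
      ∑[ i < d ] ∑[ j < d ] (B i j * B i j) + ∑[ i < d ] (- (+ 4 * c) * B i i + + 4 * (c * c) * + 1)
        ≡⟨ cong₂ _+_ (frobenius-AᵀA≡AAᵀ A) (trans (∑-distrib-+ (λ i → - (+ 4 * c) * B i i) _)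
             (cong₂ _+_ (trans (sym (*-distribˡ-sum (- (+ 4 * c)) (λ i → B i i))) (cong (- (+ 4 * c) *_) trace-frameOperator))
                        (∑-const d (+ 4 * (c * c) * + 1)))) ⟩
      ∑[ m < N ] ∑[ n < N ] ((∑[ i < d ] (A m i * A n i)) * (∑[ i < d ] (A m i * A n i))) + (- (+ 4 * c) * (+ N * c) + + d * (+ 4 * (c * c) * + 1))
        ≡⟨ cong (λ s → s + (- (+ 4 * c) * (+ N * c) + + d * (+ 4 * (c * c) * + 1)))
             (sum-cong-≗ (λ m → sum-cong-≗ (λ n → cong (λ g → g * g) (sym (·-as-∑ (K m) (K n)))))) ⟩
      ∑[ m < N ] ∑[ n < N ] ((K m · K n) * (K m · K n)) + (- (+ 4 * c) * (+ N * c) + + d * (+ 4 * (c * c) * + 1))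
        ≤⟨ ℤ.+-monoˡ-≤ _ (ℤ.≤-trans (∑-mono-≤ row-bound) (ℤ.≤-reflexive (∑-const N (+ 2 * (c * c))))) ⟩
      + N * (+ 2 * (c * c)) + (- (+ 4 * c) * (+ N * c) + + d * (+ 4 * (c * c) * + 1))
        ≡⟨ cong (λ n → n * (+ 2 * (c * c)) + (- (+ 4 * c) * (n * c) + + d * (+ 4 * (c * c) * + 1))) (ℤ.pos-+ d d) ⟩
      (+ d + + d) * (+ 2 * (c * c)) + (- (+ 4 * c) * ((+ d + + d) * c) + + d * (+ 4 * (c * c) * + 1))
        ≡⟨ ring (+ d) c ⟩
      + 0 ∎
      where
      open ℤ.≤-Reasoning
      ring : ∀ d c → (d + d) * (+ 2 * (c * c)) + (- (+ 4 * c) * ((d + d) * c) + d * (+ 4 * (c * c) * + 1)) ≡ + 0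
      ring = solve-∀

  frameOperator-tight : ∀ i j → B i j ≡ + 2 * c * δ i j
  frameOperator-tight i j = ℤ.i-j≡0⇒i≡j _ _ (i*i≡0⇒i≡0 (D i j)
    (∑-nonneg≤0⇒≡0 (λ j → i*i≥0 (D i j)) (ℤ.≤-reflexive (∑-nonneg≤0⇒≡0 (λ i → ∑-nonneg (λ j → i*i≥0 (D i j))) ∑∑D²≤0 i)) j))

  parseval : (W : Vec ℤ d) → ∑[ m < N ] ((W · K m) * (W · K m)) ≡ + 2 * c * (W · W)
  parseval W = begin
    ∑[ m < N ] ((W · K m) * (W · K m))
      ≡⟨ sum-cong-≗ (λ m → trans (cong₂ _*_ (·-as-∑ W (K m)) (·-as-∑ W (K m))) (∑-*-∑ (λ i → w i * A m i) (λ j → w j * A m j))) ⟩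
    ∑[ m < N ] ∑[ i < d ] ∑[ j < d ] ((w i * A m i) * (w j * A m j))
      ≡⟨ ∑-comm (λ m i → ∑[ j < d ] ((w i * A m i) * (w j * A m j))) ⟩
    ∑[ i < d ] ∑[ m < N ] ∑[ j < d ] ((w i * A m i) * (w j * A m j))
      ≡⟨ sum-cong-≗ (λ i → ∑-comm (λ m j → (w i * A m i) * (w j * A m j))) ⟩
    ∑[ i < d ] ∑[ j < d ] ∑[ m < N ] ((w i * A m i) * (w j * A m j))
      ≡⟨ sum-cong-≗ (λ i → sum-cong-≗ (λ j → pair i j)) ⟩
    ∑[ i < d ] ∑[ j < d ] (δ i j * (+ 2 * c * (w i * w j)))
      ≡⟨ sum-cong-≗ (λ i → ∑-δ i (λ j → + 2 * c * (w i * w j))) ⟩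
    ∑[ i < d ] (+ 2 * c * (w i * w i))
      ≡⟨ *-distribˡ-sum (+ 2 * c) (λ i → w i * w i) ⟨
    + 2 * c * ∑[ i < d ] (w i * w i)
      ≡⟨ cong (+ 2 * c *_) (·-as-∑ W W) ⟨
    + 2 * c * (W · W) ∎
    where
    open ≡-Reasoning
    w : Fin d → ℤ
    w = lookup W
    pair : ∀ i j → ∑[ m < N ] ((w i * A m i) * (w j * A m j)) ≡ δ i j * (+ 2 * c * (w i * w j))
    pair i j = begin
      ∑[ m < N ] ((w i * A m i) * (w j * A m j)) ≡⟨ sum-cong-≗ (λ m → ring₁ (w i) (w j) (A m i) (A m j)) ⟩
      ∑[ m < N ] ((w i * w j) * (A m i * A m j)) ≡⟨ *-distribˡ-sum (w i * w j) (λ m → A m i * A m j) ⟨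
      (w i * w j) * B i j                         ≡⟨ cong ((w i * w j) *_) (frameOperator-tight i j) ⟩
      (w i * w j) * (+ 2 * c * δ i j)             ≡⟨ ring₂ c (w i * w j) (δ i j) ⟩
      δ i j * (+ 2 * c * (w i * w j))             ∎
      where
      ring₁ : ∀ a b x y → (a * x) * (b * y) ≡ (a * b) * (x * y)
      ring₁ = solve-∀
      ring₂ : ∀ c v e → v * (+ 2 * c * e) ≡ e * (+ 2 * c * v)
      ring₂ = solve-∀

  ∈-crossPolytope : (W : Vec ℤ d) → W · W ≡ c → (∀ m → c ∣ W · K m) → ∃ λ m → W ≡ K m
  ∈-crossPolytope W W·W≡c c∣W·K with Fin.any? (λ m → W · K m ℤ.≟ c)
  ... | yes (m , W·Km≡c) = m , ·≡norm⇒≡ W·W≡c (norm m) W·Km≡c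
  ... | no none = contradiction (ℤ.≤-<-trans 2c²≤c² c²<2c²) (ℤ.<-irrefl refl)
    where
    f : Fin N → ℤ
    f m = (W · K m) * (W · K m)
    values : ∀ m → W · K m ≡ - c ⊎ W · K m ≡ + 0 ⊎ W · K m ≡ c
    values m = let (lo , hi) = ·-bounded {X = W} {Y = K m} W·W≡c (norm m) in bounded-multiple (c∣W·K m) lo hi
    neg*neg : ∀ c → - c * - c ≡ c * c
    neg*neg = solve-∀
    f-values : ∀ m → f m ≡ + 0 ⊎ f m ≡ c * c
    f-values m with values m
    ... | inj₁ W·Km≡-c = inj₂ (trans (cong (λ g → g * g) W·Km≡-c) (neg*neg c))
    ... | inj₂ (inj₁ W·Km≡0) = inj₁ (cong (λ g → g * g) W·Km≡0)
    ... | inj₂ (inj₂ W·Km≡c) = contradiction (m , W·Km≡c) none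
    f-antipode : ∀ m → f m ≢ + 0 → K m ≡ -ᵥ W
    f-antipode m fm≢0 with values m
    ... | inj₁ W·Km≡-c = ·≡-norm⇒≡-ᵥ W·W≡c (norm m) W·Km≡-c
    ... | inj₂ (inj₁ W·Km≡0) = contradiction (cong (λ g → g * g) W·Km≡0) fm≢0
    ... | inj₂ (inj₂ W·Km≡c) = contradiction (m , W·Km≡c) none
    2c²≤c² : + 2 * c * c ≤ c * c
    2c²≤c² = subst (_≤ c * c) (trans (parseval W) (cong (+ 2 * c *_) W·W≡c))
      (∑-atMostOne (i*i≥0 c) f-values (λ m m′ fm≢0 fm′≢0 → injective m m′ (trans (f-antipode m fm≢0) (sym (f-antipode m′ fm′≢0)))))
    c²<2c² : c * c < + 2 * c * c
    c²<2c² = subst₂ _<_ (ℤ.+-identityʳ (c * c)) (double c) (ℤ.+-monoʳ-< (c * c) (subst (_< c * c) (ℤ.*-zeroʳ c) (ℤ.*-monoˡ-<-pos c (ℤ.positive⁻¹ c))))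
      where
      double : ∀ c → c * c + c * c ≡ + 2 * c * c
      double = solve-∀

-- Integrality of the E8 lattice

sumᵥ : Vec ℤ n → ℤ
sumᵥ = foldr (λ _ → ℤ) _+_ (+ 0)

sumᵥ-distrib--ᵥ : (X Y : Vec ℤ n) → sumᵥ (X -ᵥ Y) ≡ sumᵥ X - sumᵥ Y
sumᵥ-distrib--ᵥ [] [] = refl
sumᵥ-distrib--ᵥ (x ∷ X) (y ∷ Y) rewrite sumᵥ-distrib--ᵥ X Y = ring x y (sumᵥ X) (sumᵥ Y)
  where
  ring : ∀ x y a b → x - y + (a - b) ≡ x + a - (y + b)
  ring = solve-∀

All-zipWith : (P Q R : ℤ → Set) (f : ℤ → ℤ → ℤ) → (∀ x y → P x → Q y → R (f x y)) →
              {X Y : Vec ℤ n} → VecAll.All P X → VecAll.All Q Y → VecAll.All R (zipWith f X Y)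
All-zipWith P Q R f g [] [] = []
All-zipWith P Q R f g {x ∷ X} {y ∷ Y} (px ∷ pX) (qy ∷ qY) = g x y px qy ∷ All-zipWith P Q R f g pX qY

private
  even⇒ : ∀ x → Even x → + 2 ∣ x
  even⇒ x = ∣ᵤ⇒∣ {i = x}

  odd⇒ : ∀ x → Odd x → + 2 ∣ x - + 1
  odd⇒ x = ∣ᵤ⇒∣ {i = x - + 1}

  halves : ∀ {x y} → + 2 ∣ x → + 2 ∣ y → + 4 ∣ x * y
  halves (divides a refl) (divides b refl) = divides (a * b) (ring a b)
    where
    ring : ∀ a b → a * + 2 * (b * + 2) ≡ a * b * + 4
    ring = solve-∀

  4∣⟨_⟩ : ∀ {x y z} → z ≡ x * y → + 2 ∣ x → + 2 ∣ y → + 4 ∣ z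
  4∣⟨ refl ⟩ 2∣x 2∣y = halves 2∣x 2∣y

-- For x, y even or odd as indicated, x y, x (y − 1) and (x − 1) (y − 1) are multiples of 4.
·-even-even : {X Y : Vec ℤ n} → VecAll.All Even X → VecAll.All Even Y → + 4 ∣ X · Y
·-even-even [] [] = divides (+ 0) refl
·-even-even {X = x ∷ X} {y ∷ Y} (ex ∷ eX) (ey ∷ eY) = ∣m∣n⇒∣m+n (halves (even⇒ x ex) (even⇒ y ey)) (·-even-even eX eY)

·-even-odd : {X Y : Vec ℤ n} → VecAll.All Even X → VecAll.All Odd Y → + 4 ∣ X · Y - sumᵥ X
·-even-odd [] [] = divides (+ 0) refl
·-even-odd {X = x ∷ X} {y ∷ Y} (ex ∷ eX) (oy ∷ oY) =
  subst (+ 4 ∣_) (ring x y (X · Y) (sumᵥ X))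
    (∣m∣n⇒∣m+n (4∣⟨ ring₁ x y ⟩ (even⇒ x ex) (odd⇒ y oy)) (·-even-odd eX oY))
  where
  ring₁ : ∀ x y → x * y - x ≡ x * (y - + 1)
  ring₁ = solve-∀
  ring : ∀ x y a s → (x * y - x) + (a - s) ≡ (x * y + a) - (x + s)
  ring = solve-∀

·-odd-odd : {X Y : Vec ℤ n} → VecAll.All Odd X → VecAll.All Odd Y → + 4 ∣ X · Y - sumᵥ X - sumᵥ Y + + n
·-odd-odd [] [] = divides (+ 0) refl
·-odd-odd {suc n} {x ∷ X} {y ∷ Y} (ox ∷ oX) (oy ∷ oY) =
  subst (+ 4 ∣_) (ring x y (X · Y) (sumᵥ X) (sumᵥ Y) (+ n))
    (∣m∣n⇒∣m+n (4∣⟨ ring₁ x y ⟩ (odd⇒ x ox) (odd⇒ y oy)) (·-odd-odd oX oY))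
  where
  ring₁ : ∀ x y → x * y - x - y + + 1 ≡ (x - + 1) * (y - + 1)
  ring₁ = solve-∀
  ring : ∀ x y a s t m → (x * y - x - y + + 1) + (a - s - t + m) ≡ (x * y + a) - (x + s) - (y + t) + (+ 1 + m)
  ring = solve-∀

Λ-integral : ∀ {X Y} → InΛ X → InΛ Y → + 4 ∣ X ⊙ Y
Λ-integral (inj₁ eX , _) (inj₁ eY , _) = ·-even-even eX eY
Λ-integral {X} {Y} (inj₁ eX , 4∣ΣX) (inj₂ oY , _) =
  subst (+ 4 ∣_) (ring (X · Y) (sumV X)) (∣m∣n⇒∣m+n (·-even-odd eX oY) (∣ᵤ⇒∣ 4∣ΣX))
  where
  ring : ∀ a s → (a - s) + s ≡ a
  ring = solve-∀
Λ-integral {X} {Y} (inj₂ oX , 4∣ΣX) (inj₁ eY , 4∣ΣY) =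
  subst (+ 4 ∣_) (·-comm Y X) (Λ-integral {Y} {X} (inj₁ eY , 4∣ΣY) (inj₂ oX , 4∣ΣX))
Λ-integral {X} {Y} (inj₂ oX , 4∣ΣX) (inj₂ oY , 4∣ΣY) =
  subst (+ 4 ∣_) (ring (X · Y) (sumV X) (sumV Y))
    (∣m∣n⇒∣m-n (∣m∣n⇒∣m+n (∣m∣n⇒∣m+n (·-odd-odd oX oY) (∣ᵤ⇒∣ 4∣ΣX)) (∣ᵤ⇒∣ 4∣ΣY)) (divides (+ 2) refl))
  where
  ring : ∀ a s t → (a - s - t + + 8) + s + t - + 8 ≡ a
  ring = solve-∀

private
  even-even : ∀ x y → Even x → Even y → Even (x - y)
  even-even x y ex ey = ∣⇒∣ᵤ (∣m∣n⇒∣m-n (even⇒ x ex) (even⇒ y ey))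

  odd-odd : ∀ x y → Odd x → Odd y → Even (x - y)
  odd-odd x y ox oy = ∣⇒∣ᵤ (subst (+ 2 ∣_) (ring x y) (∣m∣n⇒∣m-n (odd⇒ x ox) (odd⇒ y oy)))
    where
    ring : ∀ x y → (x - + 1) - (y - + 1) ≡ x - y
    ring = solve-∀

  even-odd : ∀ x y → Even x → Odd y → Odd (x - y)
  even-odd x y ex oy = ∣⇒∣ᵤ (subst (+ 2 ∣_) (ring x y) (∣m∣n⇒∣m-n (∣m∣n⇒∣m-n (even⇒ x ex) (odd⇒ y oy)) (divides (+ 1) refl)))
    where
    ring : ∀ x y → (x - (y - + 1)) - + 2 ≡ x - y - + 1
    ring = solve-∀

  odd-even : ∀ x y → Odd x → Even y → Odd (x - y)
  odd-even x y ox ey = ∣⇒∣ᵤ (subst (+ 2 ∣_) (ring x y) (∣m∣n⇒∣m-n (odd⇒ x ox) (even⇒ y ey)))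
    where
    ring : ∀ x y → (x - + 1) - y ≡ x - y - + 1
    ring = solve-∀

Λ--ᵥ : ∀ {X Y} → InΛ X → InΛ Y → InΛ (X -ᵥ Y)
Λ--ᵥ {X} {Y} (pX , 4∣ΣX) (pY , 4∣ΣY) = parity pX pY , ∣⇒∣ᵤ (subst (+ 4 ∣_) (sym (sumᵥ-distrib--ᵥ X Y)) (∣m∣n⇒∣m-n (∣ᵤ⇒∣ {i = sumV X} 4∣ΣX) (∣ᵤ⇒∣ {i = sumV Y} 4∣ΣY)))
  where
  parity : VecAll.All Even X ⊎ VecAll.All Odd X → VecAll.All Even Y ⊎ VecAll.All Odd Y → VecAll.All Even (X -ᵥ Y) ⊎ VecAll.All Odd (X -ᵥ Y)
  parity (inj₁ eX) (inj₁ eY) = inj₁ (All-zipWith Even Even Even _-_ even-even eX eY)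
  parity (inj₁ eX) (inj₂ oY) = inj₂ (All-zipWith Even Odd Odd _-_ even-odd eX oY)
  parity (inj₂ oX) (inj₁ eY) = inj₂ (All-zipWith Odd Even Odd _-_ odd-even oX eY)
  parity (inj₂ oX) (inj₂ oY) = inj₁ (All-zipWith Odd Odd Even _-_ odd-odd oX oY)

-- Reflections

i*n/n≡i : ∀ i n → (i * + ℕ.suc n) / + ℕ.suc n ≡ i
i*n/n≡i i n = ℤ.≤-antisym quotient≤i i≤quotient
  where
  d = + ℕ.suc n
  quotient≤i : (i * d) / d ≤ i
  quotient≤i = ℤ.*-cancelʳ-≤-pos ((i * d) / d) i d (ℤ.[n/d]*d≤n (i * d) d)
  i≤quotient : i ≤ (i * d) / d
  i≤quotient = subst (i ≤_) (trans (ℤ.pred-suc _) (sym (ℤ.div-pos-is-/ℕ (i * d) (ℕ.suc n))))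
    (ℤ.i<j⇒i≤pred[j] {j = ℤ.suc ((i * d) ℤ./ℕ ℕ.suc n)} (ℤ.*-cancelʳ-<-nonNeg d (ℤ.n<s[n/ℕd]*d (i * d) (ℕ.suc n))))

[a/n]*n≡a : ∀ {a n} → + ℕ.suc n ∣ a → a / + ℕ.suc n * + ℕ.suc n ≡ a
[a/n]*n≡a {n = n} (divides q refl) = cong (_* + ℕ.suc n) (i*n/n≡i q n)

reflect-· : ∀ R X Z → reflect R X ⊙ Z ≡ X ⊙ Z - (X ⊙ R / + 4) * (R ⊙ Z)
reflect-· R X Z = trans (·-distribʳ--ᵥ X _ Z) (cong (λ t → X ⊙ Z - t) (·-*ᵥˡ (X ⊙ R / + 4) R Z))

reflect-⊥ : ∀ R X Z → R ⊙ Z ≡ + 0 → reflect R X ⊙ Z ≡ X ⊙ Z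
reflect-⊥ R X Z R·Z≡0 = trans (reflect-· R X Z) (trans (cong (λ t → X ⊙ Z - (X ⊙ R / + 4) * t) R·Z≡0) (ring (X ⊙ Z) (X ⊙ R / + 4)))
  where
  ring : ∀ a k → a - k * + 0 ≡ a
  ring = solve-∀

module _ (R X : V) (R·R≡8 : R ⊙ R ≡ + 8) (4∣X·R : + 4 ∣ X ⊙ R) where
  private
    k = X ⊙ R / + 4
    X·R≡4k : X ⊙ R ≡ k * + 4
    X·R≡4k = sym ([a/n]*n≡a 4∣X·R)

  reflect-norm : reflect R X ⊙ reflect R X ≡ X ⊙ X
  reflect-norm = begin
    s ⊙ s                                               ≡⟨ reflect-· R X s ⟩
    X ⊙ s - k * (R ⊙ s)                                 ≡⟨ cong₂ (λ a b → a - k * b) (·-comm X s) (·-comm R s) ⟩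
    s ⊙ X - k * (s ⊙ R)                                 ≡⟨ cong₂ (λ a b → a - k * b) (reflect-· R X X) (reflect-· R X R) ⟩
    (X ⊙ X - k * (R ⊙ X)) - k * (X ⊙ R - k * (R ⊙ R))  ≡⟨ cong₂ (λ a b → (X ⊙ X - k * a) - k * (X ⊙ R - k * b)) (·-comm R X) R·R≡8 ⟩
    (X ⊙ X - k * (X ⊙ R)) - k * (X ⊙ R - k * + 8)      ≡⟨ cong (λ a → (X ⊙ X - k * a) - k * (a - k * + 8)) X·R≡4k ⟩
    (X ⊙ X - k * (k * + 4)) - k * (k * + 4 - k * + 8)  ≡⟨ ring (X ⊙ X) k ⟩
    X ⊙ X                                               ∎
    where
    open ≡-Reasoning
    s = reflect R X
    ring : ∀ a k → (a - k * (k * + 4)) - k * (k * + 4 - k * + 8) ≡ a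
    ring = solve-∀

  reflect-involutive : reflect R (reflect R X) ≡ X
  reflect-involutive = begin
    reflect R s                    ≡⟨ cong (λ t → s -ᵥ t *ᵥ R) s·R/4≡-k ⟩
    (X -ᵥ k *ᵥ R) -ᵥ (- k) *ᵥ R  ≡⟨ cancel k X R ⟩
    X                              ∎
    where
    open ≡-Reasoning
    s = reflect R X
    s·R≡-4k : s ⊙ R ≡ (- k) * + 4
    s·R≡-4k = begin
      s ⊙ R                  ≡⟨ reflect-· R X R ⟩
      X ⊙ R - k * (R ⊙ R)    ≡⟨ cong₂ (λ a b → a - k * b) X·R≡4k R·R≡8 ⟩
      k * + 4 - k * + 8      ≡⟨ ring k ⟩
      (- k) * + 4            ∎
      where
      ring : ∀ k → k * + 4 - k * + 8 ≡ (- k) * + 4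
      ring = solve-∀
    s·R/4≡-k : s ⊙ R / + 4 ≡ - k
    s·R/4≡-k = trans (cong (_/ + 4) s·R≡-4k) (i*n/n≡i (- k) 3)
    cancel : ∀ {n} k (X R : Vec ℤ n) → (X -ᵥ k *ᵥ R) -ᵥ (- k) *ᵥ R ≡ X
    cancel k [] [] = refl
    cancel k (x ∷ X) (r ∷ R) = cong₂ _∷_ (ring k x r) (cancel k X R)
      where
      ring : ∀ k x r → (x - k * r) - (- k) * r ≡ x
      ring = solve-∀

reflect-self : ∀ {R} → R ⊙ R ≡ + 8 → reflect R R ≡ -ᵥ R
reflect-self {R} R·R≡8 = trans (cong (λ t → R -ᵥ (t / + 4) *ᵥ R) R·R≡8) (R-2R R)
  where
  R-2R : ∀ {n} (R : Vec ℤ n) → R -ᵥ + 2 *ᵥ R ≡ -ᵥ R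
  R-2R [] = refl
  R-2R (r ∷ R) = cong₂ _∷_ (ring r) (R-2R R)
    where
    ring : ∀ r → r - + 2 * r ≡ - r
    ring = solve-∀

-- Enumeration of the 240 roots

-- The doubled coordinates of a root lie in {−2, …, 2}; roots are listed as vectors of such codes.
data Coord : Set where
  −2 −1 0c +1 +2 : Coord

⟦_⟧ : Coord → ℤ
⟦ −2 ⟧ = -[1+ 1 ]
⟦ −1 ⟧ = -[1+ 0 ]
⟦ 0c ⟧ = + 0
⟦ +1 ⟧ = + 1
⟦ +2 ⟧ = + 2

⟦_⟧ᵥ : ∀ {n} → Vec Coord n → Vec ℤ n
⟦_⟧ᵥ = Vec.map ⟦_⟧

-- Evaluating ℤ multiplication is slow; multiplying by a code only needs negation and addition.
_*ᶜ_ : Coord → ℤ → ℤ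
−2 *ᶜ z = - (z + z)
−1 *ᶜ z = - z
0c *ᶜ z = + 0
+1 *ᶜ z = z
+2 *ᶜ z = z + z

*ᶜ-sound : ∀ a z → a *ᶜ z ≡ ⟦ a ⟧ * z
*ᶜ-sound −2 z = ring z
  where
  ring : ∀ z → - (z + z) ≡ -[1+ 1 ] * z
  ring = solve-∀
*ᶜ-sound −1 z = sym (ℤ.-1*i≡-i z)
*ᶜ-sound 0c z = sym (ℤ.*-zeroˡ z)
*ᶜ-sound +1 z = sym (ℤ.*-identityˡ z)
*ᶜ-sound +2 z = ring z
  where
  ring : ∀ z → z + z ≡ + 2 * z
  ring = solve-∀

infix 20 _·ᶜ_

_·ᶜ_ : ∀ {n} → Vec Coord n → Vec Coord n → ℤ
[] ·ᶜ [] = + 0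
(a ∷ as) ·ᶜ (b ∷ bs) = a *ᶜ ⟦ b ⟧ + as ·ᶜ bs

·ᶜ-sound : ∀ {n} (as bs : Vec Coord n) → ⟦ as ⟧ᵥ · ⟦ bs ⟧ᵥ ≡ as ·ᶜ bs
·ᶜ-sound [] [] = refl
·ᶜ-sound (a ∷ as) (b ∷ bs) = cong₂ _+_ (sym (*ᶜ-sound a ⟦ b ⟧)) (·ᶜ-sound as bs)

rootCodes : List (Vec Coord 8)
rootCodes =
  (+2 ∷ +2 ∷ 0c ∷ 0c ∷ 0c ∷ 0c ∷ 0c ∷ 0c ∷ []) ∷
  (+2 ∷ −2 ∷ 0c ∷ 0c ∷ 0c ∷ 0c ∷ 0c ∷ 0c ∷ []) ∷
  (−2 ∷ +2 ∷ 0c ∷ 0c ∷ 0c ∷ 0c ∷ 0c ∷ 0c ∷ []) ∷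
  (−2 ∷ −2 ∷ 0c ∷ 0c ∷ 0c ∷ 0c ∷ 0c ∷ 0c ∷ []) ∷
  (+2 ∷ 0c ∷ +2 ∷ 0c ∷ 0c ∷ 0c ∷ 0c ∷ 0c ∷ []) ∷
  (+2 ∷ 0c ∷ −2 ∷ 0c ∷ 0c ∷ 0c ∷ 0c ∷ 0c ∷ []) ∷
  (−2 ∷ 0c ∷ +2 ∷ 0c ∷ 0c ∷ 0c ∷ 0c ∷ 0c ∷ []) ∷
  (−2 ∷ 0c ∷ −2 ∷ 0c ∷ 0c ∷ 0c ∷ 0c ∷ 0c ∷ []) ∷
  (+2 ∷ 0c ∷ 0c ∷ +2 ∷ 0c ∷ 0c ∷ 0c ∷ 0c ∷ []) ∷
  (+2 ∷ 0c ∷ 0c ∷ −2 ∷ 0c ∷ 0c ∷ 0c ∷ 0c ∷ []) ∷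
  (−2 ∷ 0c ∷ 0c ∷ +2 ∷ 0c ∷ 0c ∷ 0c ∷ 0c ∷ []) ∷
  (−2 ∷ 0c ∷ 0c ∷ −2 ∷ 0c ∷ 0c ∷ 0c ∷ 0c ∷ []) ∷
  (+2 ∷ 0c ∷ 0c ∷ 0c ∷ +2 ∷ 0c ∷ 0c ∷ 0c ∷ []) ∷
  (+2 ∷ 0c ∷ 0c ∷ 0c ∷ −2 ∷ 0c ∷ 0c ∷ 0c ∷ []) ∷
  (−2 ∷ 0c ∷ 0c ∷ 0c ∷ +2 ∷ 0c ∷ 0c ∷ 0c ∷ []) ∷
  (−2 ∷ 0c ∷ 0c ∷ 0c ∷ −2 ∷ 0c ∷ 0c ∷ 0c ∷ []) ∷
  (+2 ∷ 0c ∷ 0c ∷ 0c ∷ 0c ∷ +2 ∷ 0c ∷ 0c ∷ []) ∷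
  (+2 ∷ 0c ∷ 0c ∷ 0c ∷ 0c ∷ −2 ∷ 0c ∷ 0c ∷ []) ∷
  (−2 ∷ 0c ∷ 0c ∷ 0c ∷ 0c ∷ +2 ∷ 0c ∷ 0c ∷ []) ∷
  (−2 ∷ 0c ∷ 0c ∷ 0c ∷ 0c ∷ −2 ∷ 0c ∷ 0c ∷ []) ∷
  (+2 ∷ 0c ∷ 0c ∷ 0c ∷ 0c ∷ 0c ∷ +2 ∷ 0c ∷ []) ∷
  (+2 ∷ 0c ∷ 0c ∷ 0c ∷ 0c ∷ 0c ∷ −2 ∷ 0c ∷ []) ∷
  (−2 ∷ 0c ∷ 0c ∷ 0c ∷ 0c ∷ 0c ∷ +2 ∷ 0c ∷ []) ∷
  (−2 ∷ 0c ∷ 0c ∷ 0c ∷ 0c ∷ 0c ∷ −2 ∷ 0c ∷ []) ∷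
  (+2 ∷ 0c ∷ 0c ∷ 0c ∷ 0c ∷ 0c ∷ 0c ∷ +2 ∷ []) ∷
  (+2 ∷ 0c ∷ 0c ∷ 0c ∷ 0c ∷ 0c ∷ 0c ∷ −2 ∷ []) ∷
  (−2 ∷ 0c ∷ 0c ∷ 0c ∷ 0c ∷ 0c ∷ 0c ∷ +2 ∷ []) ∷
  (−2 ∷ 0c ∷ 0c ∷ 0c ∷ 0c ∷ 0c ∷ 0c ∷ −2 ∷ []) ∷
  (0c ∷ +2 ∷ +2 ∷ 0c ∷ 0c ∷ 0c ∷ 0c ∷ 0c ∷ []) ∷
  (0c ∷ +2 ∷ −2 ∷ 0c ∷ 0c ∷ 0c ∷ 0c ∷ 0c ∷ []) ∷
  (0c ∷ −2 ∷ +2 ∷ 0c ∷ 0c ∷ 0c ∷ 0c ∷ 0c ∷ []) ∷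
  (0c ∷ −2 ∷ −2 ∷ 0c ∷ 0c ∷ 0c ∷ 0c ∷ 0c ∷ []) ∷
  (0c ∷ +2 ∷ 0c ∷ +2 ∷ 0c ∷ 0c ∷ 0c ∷ 0c ∷ []) ∷
  (0c ∷ +2 ∷ 0c ∷ −2 ∷ 0c ∷ 0c ∷ 0c ∷ 0c ∷ []) ∷
  (0c ∷ −2 ∷ 0c ∷ +2 ∷ 0c ∷ 0c ∷ 0c ∷ 0c ∷ []) ∷
  (0c ∷ −2 ∷ 0c ∷ −2 ∷ 0c ∷ 0c ∷ 0c ∷ 0c ∷ []) ∷
  (0c ∷ +2 ∷ 0c ∷ 0c ∷ +2 ∷ 0c ∷ 0c ∷ 0c ∷ []) ∷
  (0c ∷ +2 ∷ 0c ∷ 0c ∷ −2 ∷ 0c ∷ 0c ∷ 0c ∷ []) ∷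
  (0c ∷ −2 ∷ 0c ∷ 0c ∷ +2 ∷ 0c ∷ 0c ∷ 0c ∷ []) ∷
  (0c ∷ −2 ∷ 0c ∷ 0c ∷ −2 ∷ 0c ∷ 0c ∷ 0c ∷ []) ∷
  (0c ∷ +2 ∷ 0c ∷ 0c ∷ 0c ∷ +2 ∷ 0c ∷ 0c ∷ []) ∷
  (0c ∷ +2 ∷ 0c ∷ 0c ∷ 0c ∷ −2 ∷ 0c ∷ 0c ∷ []) ∷
  (0c ∷ −2 ∷ 0c ∷ 0c ∷ 0c ∷ +2 ∷ 0c ∷ 0c ∷ []) ∷
  (0c ∷ −2 ∷ 0c ∷ 0c ∷ 0c ∷ −2 ∷ 0c ∷ 0c ∷ []) ∷
  (0c ∷ +2 ∷ 0c ∷ 0c ∷ 0c ∷ 0c ∷ +2 ∷ 0c ∷ []) ∷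
  (0c ∷ +2 ∷ 0c ∷ 0c ∷ 0c ∷ 0c ∷ −2 ∷ 0c ∷ []) ∷
  (0c ∷ −2 ∷ 0c ∷ 0c ∷ 0c ∷ 0c ∷ +2 ∷ 0c ∷ []) ∷
  (0c ∷ −2 ∷ 0c ∷ 0c ∷ 0c ∷ 0c ∷ −2 ∷ 0c ∷ []) ∷
  (0c ∷ +2 ∷ 0c ∷ 0c ∷ 0c ∷ 0c ∷ 0c ∷ +2 ∷ []) ∷
  (0c ∷ +2 ∷ 0c ∷ 0c ∷ 0c ∷ 0c ∷ 0c ∷ −2 ∷ []) ∷
  (0c ∷ −2 ∷ 0c ∷ 0c ∷ 0c ∷ 0c ∷ 0c ∷ +2 ∷ []) ∷
  (0c ∷ −2 ∷ 0c ∷ 0c ∷ 0c ∷ 0c ∷ 0c ∷ −2 ∷ []) ∷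
  (0c ∷ 0c ∷ +2 ∷ +2 ∷ 0c ∷ 0c ∷ 0c ∷ 0c ∷ []) ∷
  (0c ∷ 0c ∷ +2 ∷ −2 ∷ 0c ∷ 0c ∷ 0c ∷ 0c ∷ []) ∷
  (0c ∷ 0c ∷ −2 ∷ +2 ∷ 0c ∷ 0c ∷ 0c ∷ 0c ∷ []) ∷
  (0c ∷ 0c ∷ −2 ∷ −2 ∷ 0c ∷ 0c ∷ 0c ∷ 0c ∷ []) ∷
  (0c ∷ 0c ∷ +2 ∷ 0c ∷ +2 ∷ 0c ∷ 0c ∷ 0c ∷ []) ∷
  (0c ∷ 0c ∷ +2 ∷ 0c ∷ −2 ∷ 0c ∷ 0c ∷ 0c ∷ []) ∷
  (0c ∷ 0c ∷ −2 ∷ 0c ∷ +2 ∷ 0c ∷ 0c ∷ 0c ∷ []) ∷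
  (0c ∷ 0c ∷ −2 ∷ 0c ∷ −2 ∷ 0c ∷ 0c ∷ 0c ∷ []) ∷
  (0c ∷ 0c ∷ +2 ∷ 0c ∷ 0c ∷ +2 ∷ 0c ∷ 0c ∷ []) ∷
  (0c ∷ 0c ∷ +2 ∷ 0c ∷ 0c ∷ −2 ∷ 0c ∷ 0c ∷ []) ∷
  (0c ∷ 0c ∷ −2 ∷ 0c ∷ 0c ∷ +2 ∷ 0c ∷ 0c ∷ []) ∷
  (0c ∷ 0c ∷ −2 ∷ 0c ∷ 0c ∷ −2 ∷ 0c ∷ 0c ∷ []) ∷
  (0c ∷ 0c ∷ +2 ∷ 0c ∷ 0c ∷ 0c ∷ +2 ∷ 0c ∷ []) ∷
  (0c ∷ 0c ∷ +2 ∷ 0c ∷ 0c ∷ 0c ∷ −2 ∷ 0c ∷ []) ∷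
  (0c ∷ 0c ∷ −2 ∷ 0c ∷ 0c ∷ 0c ∷ +2 ∷ 0c ∷ []) ∷
  (0c ∷ 0c ∷ −2 ∷ 0c ∷ 0c ∷ 0c ∷ −2 ∷ 0c ∷ []) ∷
  (0c ∷ 0c ∷ +2 ∷ 0c ∷ 0c ∷ 0c ∷ 0c ∷ +2 ∷ []) ∷
  (0c ∷ 0c ∷ +2 ∷ 0c ∷ 0c ∷ 0c ∷ 0c ∷ −2 ∷ []) ∷
  (0c ∷ 0c ∷ −2 ∷ 0c ∷ 0c ∷ 0c ∷ 0c ∷ +2 ∷ []) ∷
  (0c ∷ 0c ∷ −2 ∷ 0c ∷ 0c ∷ 0c ∷ 0c ∷ −2 ∷ []) ∷
  (0c ∷ 0c ∷ 0c ∷ +2 ∷ +2 ∷ 0c ∷ 0c ∷ 0c ∷ []) ∷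
  (0c ∷ 0c ∷ 0c ∷ +2 ∷ −2 ∷ 0c ∷ 0c ∷ 0c ∷ []) ∷
  (0c ∷ 0c ∷ 0c ∷ −2 ∷ +2 ∷ 0c ∷ 0c ∷ 0c ∷ []) ∷
  (0c ∷ 0c ∷ 0c ∷ −2 ∷ −2 ∷ 0c ∷ 0c ∷ 0c ∷ []) ∷
  (0c ∷ 0c ∷ 0c ∷ +2 ∷ 0c ∷ +2 ∷ 0c ∷ 0c ∷ []) ∷
  (0c ∷ 0c ∷ 0c ∷ +2 ∷ 0c ∷ −2 ∷ 0c ∷ 0c ∷ []) ∷
  (0c ∷ 0c ∷ 0c ∷ −2 ∷ 0c ∷ +2 ∷ 0c ∷ 0c ∷ []) ∷
  (0c ∷ 0c ∷ 0c ∷ −2 ∷ 0c ∷ −2 ∷ 0c ∷ 0c ∷ []) ∷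
  (0c ∷ 0c ∷ 0c ∷ +2 ∷ 0c ∷ 0c ∷ +2 ∷ 0c ∷ []) ∷
  (0c ∷ 0c ∷ 0c ∷ +2 ∷ 0c ∷ 0c ∷ −2 ∷ 0c ∷ []) ∷
  (0c ∷ 0c ∷ 0c ∷ −2 ∷ 0c ∷ 0c ∷ +2 ∷ 0c ∷ []) ∷
  (0c ∷ 0c ∷ 0c ∷ −2 ∷ 0c ∷ 0c ∷ −2 ∷ 0c ∷ []) ∷
  (0c ∷ 0c ∷ 0c ∷ +2 ∷ 0c ∷ 0c ∷ 0c ∷ +2 ∷ []) ∷
  (0c ∷ 0c ∷ 0c ∷ +2 ∷ 0c ∷ 0c ∷ 0c ∷ −2 ∷ []) ∷
  (0c ∷ 0c ∷ 0c ∷ −2 ∷ 0c ∷ 0c ∷ 0c ∷ +2 ∷ []) ∷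
  (0c ∷ 0c ∷ 0c ∷ −2 ∷ 0c ∷ 0c ∷ 0c ∷ −2 ∷ []) ∷
  (0c ∷ 0c ∷ 0c ∷ 0c ∷ +2 ∷ +2 ∷ 0c ∷ 0c ∷ []) ∷
  (0c ∷ 0c ∷ 0c ∷ 0c ∷ +2 ∷ −2 ∷ 0c ∷ 0c ∷ []) ∷
  (0c ∷ 0c ∷ 0c ∷ 0c ∷ −2 ∷ +2 ∷ 0c ∷ 0c ∷ []) ∷
  (0c ∷ 0c ∷ 0c ∷ 0c ∷ −2 ∷ −2 ∷ 0c ∷ 0c ∷ []) ∷
  (0c ∷ 0c ∷ 0c ∷ 0c ∷ +2 ∷ 0c ∷ +2 ∷ 0c ∷ []) ∷
  (0c ∷ 0c ∷ 0c ∷ 0c ∷ +2 ∷ 0c ∷ −2 ∷ 0c ∷ []) ∷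
  (0c ∷ 0c ∷ 0c ∷ 0c ∷ −2 ∷ 0c ∷ +2 ∷ 0c ∷ []) ∷
  (0c ∷ 0c ∷ 0c ∷ 0c ∷ −2 ∷ 0c ∷ −2 ∷ 0c ∷ []) ∷
  (0c ∷ 0c ∷ 0c ∷ 0c ∷ +2 ∷ 0c ∷ 0c ∷ +2 ∷ []) ∷
  (0c ∷ 0c ∷ 0c ∷ 0c ∷ +2 ∷ 0c ∷ 0c ∷ −2 ∷ []) ∷
  (0c ∷ 0c ∷ 0c ∷ 0c ∷ −2 ∷ 0c ∷ 0c ∷ +2 ∷ []) ∷
  (0c ∷ 0c ∷ 0c ∷ 0c ∷ −2 ∷ 0c ∷ 0c ∷ −2 ∷ []) ∷
  (0c ∷ 0c ∷ 0c ∷ 0c ∷ 0c ∷ +2 ∷ +2 ∷ 0c ∷ []) ∷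
  (0c ∷ 0c ∷ 0c ∷ 0c ∷ 0c ∷ +2 ∷ −2 ∷ 0c ∷ []) ∷
  (0c ∷ 0c ∷ 0c ∷ 0c ∷ 0c ∷ −2 ∷ +2 ∷ 0c ∷ []) ∷
  (0c ∷ 0c ∷ 0c ∷ 0c ∷ 0c ∷ −2 ∷ −2 ∷ 0c ∷ []) ∷
  (0c ∷ 0c ∷ 0c ∷ 0c ∷ 0c ∷ +2 ∷ 0c ∷ +2 ∷ []) ∷
  (0c ∷ 0c ∷ 0c ∷ 0c ∷ 0c ∷ +2 ∷ 0c ∷ −2 ∷ []) ∷
  (0c ∷ 0c ∷ 0c ∷ 0c ∷ 0c ∷ −2 ∷ 0c ∷ +2 ∷ []) ∷
  (0c ∷ 0c ∷ 0c ∷ 0c ∷ 0c ∷ −2 ∷ 0c ∷ −2 ∷ []) ∷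
  (0c ∷ 0c ∷ 0c ∷ 0c ∷ 0c ∷ 0c ∷ +2 ∷ +2 ∷ []) ∷
  (0c ∷ 0c ∷ 0c ∷ 0c ∷ 0c ∷ 0c ∷ +2 ∷ −2 ∷ []) ∷
  (0c ∷ 0c ∷ 0c ∷ 0c ∷ 0c ∷ 0c ∷ −2 ∷ +2 ∷ []) ∷
  (0c ∷ 0c ∷ 0c ∷ 0c ∷ 0c ∷ 0c ∷ −2 ∷ −2 ∷ []) ∷
  (+1 ∷ +1 ∷ +1 ∷ +1 ∷ +1 ∷ +1 ∷ +1 ∷ +1 ∷ []) ∷
  (+1 ∷ +1 ∷ +1 ∷ +1 ∷ +1 ∷ +1 ∷ −1 ∷ −1 ∷ []) ∷
  (+1 ∷ +1 ∷ +1 ∷ +1 ∷ +1 ∷ −1 ∷ +1 ∷ −1 ∷ []) ∷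
  (+1 ∷ +1 ∷ +1 ∷ +1 ∷ +1 ∷ −1 ∷ −1 ∷ +1 ∷ []) ∷
  (+1 ∷ +1 ∷ +1 ∷ +1 ∷ −1 ∷ +1 ∷ +1 ∷ −1 ∷ []) ∷
  (+1 ∷ +1 ∷ +1 ∷ +1 ∷ −1 ∷ +1 ∷ −1 ∷ +1 ∷ []) ∷
  (+1 ∷ +1 ∷ +1 ∷ +1 ∷ −1 ∷ −1 ∷ +1 ∷ +1 ∷ []) ∷
  (+1 ∷ +1 ∷ +1 ∷ +1 ∷ −1 ∷ −1 ∷ −1 ∷ −1 ∷ []) ∷
  (+1 ∷ +1 ∷ +1 ∷ −1 ∷ +1 ∷ +1 ∷ +1 ∷ −1 ∷ []) ∷
  (+1 ∷ +1 ∷ +1 ∷ −1 ∷ +1 ∷ +1 ∷ −1 ∷ +1 ∷ []) ∷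
  (+1 ∷ +1 ∷ +1 ∷ −1 ∷ +1 ∷ −1 ∷ +1 ∷ +1 ∷ []) ∷
  (+1 ∷ +1 ∷ +1 ∷ −1 ∷ +1 ∷ −1 ∷ −1 ∷ −1 ∷ []) ∷
  (+1 ∷ +1 ∷ +1 ∷ −1 ∷ −1 ∷ +1 ∷ +1 ∷ +1 ∷ []) ∷
  (+1 ∷ +1 ∷ +1 ∷ −1 ∷ −1 ∷ +1 ∷ −1 ∷ −1 ∷ []) ∷
  (+1 ∷ +1 ∷ +1 ∷ −1 ∷ −1 ∷ −1 ∷ +1 ∷ −1 ∷ []) ∷
  (+1 ∷ +1 ∷ +1 ∷ −1 ∷ −1 ∷ −1 ∷ −1 ∷ +1 ∷ []) ∷
  (+1 ∷ +1 ∷ −1 ∷ +1 ∷ +1 ∷ +1 ∷ +1 ∷ −1 ∷ []) ∷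
  (+1 ∷ +1 ∷ −1 ∷ +1 ∷ +1 ∷ +1 ∷ −1 ∷ +1 ∷ []) ∷
  (+1 ∷ +1 ∷ −1 ∷ +1 ∷ +1 ∷ −1 ∷ +1 ∷ +1 ∷ []) ∷
  (+1 ∷ +1 ∷ −1 ∷ +1 ∷ +1 ∷ −1 ∷ −1 ∷ −1 ∷ []) ∷
  (+1 ∷ +1 ∷ −1 ∷ +1 ∷ −1 ∷ +1 ∷ +1 ∷ +1 ∷ []) ∷
  (+1 ∷ +1 ∷ −1 ∷ +1 ∷ −1 ∷ +1 ∷ −1 ∷ −1 ∷ []) ∷
  (+1 ∷ +1 ∷ −1 ∷ +1 ∷ −1 ∷ −1 ∷ +1 ∷ −1 ∷ []) ∷
  (+1 ∷ +1 ∷ −1 ∷ +1 ∷ −1 ∷ −1 ∷ −1 ∷ +1 ∷ []) ∷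
  (+1 ∷ +1 ∷ −1 ∷ −1 ∷ +1 ∷ +1 ∷ +1 ∷ +1 ∷ []) ∷
  (+1 ∷ +1 ∷ −1 ∷ −1 ∷ +1 ∷ +1 ∷ −1 ∷ −1 ∷ []) ∷
  (+1 ∷ +1 ∷ −1 ∷ −1 ∷ +1 ∷ −1 ∷ +1 ∷ −1 ∷ []) ∷
  (+1 ∷ +1 ∷ −1 ∷ −1 ∷ +1 ∷ −1 ∷ −1 ∷ +1 ∷ []) ∷
  (+1 ∷ +1 ∷ −1 ∷ −1 ∷ −1 ∷ +1 ∷ +1 ∷ −1 ∷ []) ∷
  (+1 ∷ +1 ∷ −1 ∷ −1 ∷ −1 ∷ +1 ∷ −1 ∷ +1 ∷ []) ∷
  (+1 ∷ +1 ∷ −1 ∷ −1 ∷ −1 ∷ −1 ∷ +1 ∷ +1 ∷ []) ∷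
  (+1 ∷ +1 ∷ −1 ∷ −1 ∷ −1 ∷ −1 ∷ −1 ∷ −1 ∷ []) ∷
  (+1 ∷ −1 ∷ +1 ∷ +1 ∷ +1 ∷ +1 ∷ +1 ∷ −1 ∷ []) ∷
  (+1 ∷ −1 ∷ +1 ∷ +1 ∷ +1 ∷ +1 ∷ −1 ∷ +1 ∷ []) ∷
  (+1 ∷ −1 ∷ +1 ∷ +1 ∷ +1 ∷ −1 ∷ +1 ∷ +1 ∷ []) ∷
  (+1 ∷ −1 ∷ +1 ∷ +1 ∷ +1 ∷ −1 ∷ −1 ∷ −1 ∷ []) ∷
  (+1 ∷ −1 ∷ +1 ∷ +1 ∷ −1 ∷ +1 ∷ +1 ∷ +1 ∷ []) ∷
  (+1 ∷ −1 ∷ +1 ∷ +1 ∷ −1 ∷ +1 ∷ −1 ∷ −1 ∷ []) ∷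
  (+1 ∷ −1 ∷ +1 ∷ +1 ∷ −1 ∷ −1 ∷ +1 ∷ −1 ∷ []) ∷
  (+1 ∷ −1 ∷ +1 ∷ +1 ∷ −1 ∷ −1 ∷ −1 ∷ +1 ∷ []) ∷
  (+1 ∷ −1 ∷ +1 ∷ −1 ∷ +1 ∷ +1 ∷ +1 ∷ +1 ∷ []) ∷
  (+1 ∷ −1 ∷ +1 ∷ −1 ∷ +1 ∷ +1 ∷ −1 ∷ −1 ∷ []) ∷
  (+1 ∷ −1 ∷ +1 ∷ −1 ∷ +1 ∷ −1 ∷ +1 ∷ −1 ∷ []) ∷
  (+1 ∷ −1 ∷ +1 ∷ −1 ∷ +1 ∷ −1 ∷ −1 ∷ +1 ∷ []) ∷
  (+1 ∷ −1 ∷ +1 ∷ −1 ∷ −1 ∷ +1 ∷ +1 ∷ −1 ∷ []) ∷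
  (+1 ∷ −1 ∷ +1 ∷ −1 ∷ −1 ∷ +1 ∷ −1 ∷ +1 ∷ []) ∷
  (+1 ∷ −1 ∷ +1 ∷ −1 ∷ −1 ∷ −1 ∷ +1 ∷ +1 ∷ []) ∷
  (+1 ∷ −1 ∷ +1 ∷ −1 ∷ −1 ∷ −1 ∷ −1 ∷ −1 ∷ []) ∷
  (+1 ∷ −1 ∷ −1 ∷ +1 ∷ +1 ∷ +1 ∷ +1 ∷ +1 ∷ []) ∷
  (+1 ∷ −1 ∷ −1 ∷ +1 ∷ +1 ∷ +1 ∷ −1 ∷ −1 ∷ []) ∷
  (+1 ∷ −1 ∷ −1 ∷ +1 ∷ +1 ∷ −1 ∷ +1 ∷ −1 ∷ []) ∷
  (+1 ∷ −1 ∷ −1 ∷ +1 ∷ +1 ∷ −1 ∷ −1 ∷ +1 ∷ []) ∷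
  (+1 ∷ −1 ∷ −1 ∷ +1 ∷ −1 ∷ +1 ∷ +1 ∷ −1 ∷ []) ∷
  (+1 ∷ −1 ∷ −1 ∷ +1 ∷ −1 ∷ +1 ∷ −1 ∷ +1 ∷ []) ∷
  (+1 ∷ −1 ∷ −1 ∷ +1 ∷ −1 ∷ −1 ∷ +1 ∷ +1 ∷ []) ∷
  (+1 ∷ −1 ∷ −1 ∷ +1 ∷ −1 ∷ −1 ∷ −1 ∷ −1 ∷ []) ∷
  (+1 ∷ −1 ∷ −1 ∷ −1 ∷ +1 ∷ +1 ∷ +1 ∷ −1 ∷ []) ∷
  (+1 ∷ −1 ∷ −1 ∷ −1 ∷ +1 ∷ +1 ∷ −1 ∷ +1 ∷ []) ∷
  (+1 ∷ −1 ∷ −1 ∷ −1 ∷ +1 ∷ −1 ∷ +1 ∷ +1 ∷ []) ∷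
  (+1 ∷ −1 ∷ −1 ∷ −1 ∷ +1 ∷ −1 ∷ −1 ∷ −1 ∷ []) ∷
  (+1 ∷ −1 ∷ −1 ∷ −1 ∷ −1 ∷ +1 ∷ +1 ∷ +1 ∷ []) ∷
  (+1 ∷ −1 ∷ −1 ∷ −1 ∷ −1 ∷ +1 ∷ −1 ∷ −1 ∷ []) ∷
  (+1 ∷ −1 ∷ −1 ∷ −1 ∷ −1 ∷ −1 ∷ +1 ∷ −1 ∷ []) ∷
  (+1 ∷ −1 ∷ −1 ∷ −1 ∷ −1 ∷ −1 ∷ −1 ∷ +1 ∷ []) ∷
  (−1 ∷ +1 ∷ +1 ∷ +1 ∷ +1 ∷ +1 ∷ +1 ∷ −1 ∷ []) ∷
  (−1 ∷ +1 ∷ +1 ∷ +1 ∷ +1 ∷ +1 ∷ −1 ∷ +1 ∷ []) ∷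
  (−1 ∷ +1 ∷ +1 ∷ +1 ∷ +1 ∷ −1 ∷ +1 ∷ +1 ∷ []) ∷
  (−1 ∷ +1 ∷ +1 ∷ +1 ∷ +1 ∷ −1 ∷ −1 ∷ −1 ∷ []) ∷
  (−1 ∷ +1 ∷ +1 ∷ +1 ∷ −1 ∷ +1 ∷ +1 ∷ +1 ∷ []) ∷
  (−1 ∷ +1 ∷ +1 ∷ +1 ∷ −1 ∷ +1 ∷ −1 ∷ −1 ∷ []) ∷
  (−1 ∷ +1 ∷ +1 ∷ +1 ∷ −1 ∷ −1 ∷ +1 ∷ −1 ∷ []) ∷
  (−1 ∷ +1 ∷ +1 ∷ +1 ∷ −1 ∷ −1 ∷ −1 ∷ +1 ∷ []) ∷
  (−1 ∷ +1 ∷ +1 ∷ −1 ∷ +1 ∷ +1 ∷ +1 ∷ +1 ∷ []) ∷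
  (−1 ∷ +1 ∷ +1 ∷ −1 ∷ +1 ∷ +1 ∷ −1 ∷ −1 ∷ []) ∷
  (−1 ∷ +1 ∷ +1 ∷ −1 ∷ +1 ∷ −1 ∷ +1 ∷ −1 ∷ []) ∷
  (−1 ∷ +1 ∷ +1 ∷ −1 ∷ +1 ∷ −1 ∷ −1 ∷ +1 ∷ []) ∷
  (−1 ∷ +1 ∷ +1 ∷ −1 ∷ −1 ∷ +1 ∷ +1 ∷ −1 ∷ []) ∷
  (−1 ∷ +1 ∷ +1 ∷ −1 ∷ −1 ∷ +1 ∷ −1 ∷ +1 ∷ []) ∷
  (−1 ∷ +1 ∷ +1 ∷ −1 ∷ −1 ∷ −1 ∷ +1 ∷ +1 ∷ []) ∷
  (−1 ∷ +1 ∷ +1 ∷ −1 ∷ −1 ∷ −1 ∷ −1 ∷ −1 ∷ []) ∷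
  (−1 ∷ +1 ∷ −1 ∷ +1 ∷ +1 ∷ +1 ∷ +1 ∷ +1 ∷ []) ∷
  (−1 ∷ +1 ∷ −1 ∷ +1 ∷ +1 ∷ +1 ∷ −1 ∷ −1 ∷ []) ∷
  (−1 ∷ +1 ∷ −1 ∷ +1 ∷ +1 ∷ −1 ∷ +1 ∷ −1 ∷ []) ∷
  (−1 ∷ +1 ∷ −1 ∷ +1 ∷ +1 ∷ −1 ∷ −1 ∷ +1 ∷ []) ∷
  (−1 ∷ +1 ∷ −1 ∷ +1 ∷ −1 ∷ +1 ∷ +1 ∷ −1 ∷ []) ∷
  (−1 ∷ +1 ∷ −1 ∷ +1 ∷ −1 ∷ +1 ∷ −1 ∷ +1 ∷ []) ∷
  (−1 ∷ +1 ∷ −1 ∷ +1 ∷ −1 ∷ −1 ∷ +1 ∷ +1 ∷ []) ∷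
  (−1 ∷ +1 ∷ −1 ∷ +1 ∷ −1 ∷ −1 ∷ −1 ∷ −1 ∷ []) ∷
  (−1 ∷ +1 ∷ −1 ∷ −1 ∷ +1 ∷ +1 ∷ +1 ∷ −1 ∷ []) ∷
  (−1 ∷ +1 ∷ −1 ∷ −1 ∷ +1 ∷ +1 ∷ −1 ∷ +1 ∷ []) ∷
  (−1 ∷ +1 ∷ −1 ∷ −1 ∷ +1 ∷ −1 ∷ +1 ∷ +1 ∷ []) ∷
  (−1 ∷ +1 ∷ −1 ∷ −1 ∷ +1 ∷ −1 ∷ −1 ∷ −1 ∷ []) ∷
  (−1 ∷ +1 ∷ −1 ∷ −1 ∷ −1 ∷ +1 ∷ +1 ∷ +1 ∷ []) ∷
  (−1 ∷ +1 ∷ −1 ∷ −1 ∷ −1 ∷ +1 ∷ −1 ∷ −1 ∷ []) ∷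
  (−1 ∷ +1 ∷ −1 ∷ −1 ∷ −1 ∷ −1 ∷ +1 ∷ −1 ∷ []) ∷
  (−1 ∷ +1 ∷ −1 ∷ −1 ∷ −1 ∷ −1 ∷ −1 ∷ +1 ∷ []) ∷
  (−1 ∷ −1 ∷ +1 ∷ +1 ∷ +1 ∷ +1 ∷ +1 ∷ +1 ∷ []) ∷
  (−1 ∷ −1 ∷ +1 ∷ +1 ∷ +1 ∷ +1 ∷ −1 ∷ −1 ∷ []) ∷
  (−1 ∷ −1 ∷ +1 ∷ +1 ∷ +1 ∷ −1 ∷ +1 ∷ −1 ∷ []) ∷
  (−1 ∷ −1 ∷ +1 ∷ +1 ∷ +1 ∷ −1 ∷ −1 ∷ +1 ∷ []) ∷
  (−1 ∷ −1 ∷ +1 ∷ +1 ∷ −1 ∷ +1 ∷ +1 ∷ −1 ∷ []) ∷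
  (−1 ∷ −1 ∷ +1 ∷ +1 ∷ −1 ∷ +1 ∷ −1 ∷ +1 ∷ []) ∷
  (−1 ∷ −1 ∷ +1 ∷ +1 ∷ −1 ∷ −1 ∷ +1 ∷ +1 ∷ []) ∷
  (−1 ∷ −1 ∷ +1 ∷ +1 ∷ −1 ∷ −1 ∷ −1 ∷ −1 ∷ []) ∷
  (−1 ∷ −1 ∷ +1 ∷ −1 ∷ +1 ∷ +1 ∷ +1 ∷ −1 ∷ []) ∷
  (−1 ∷ −1 ∷ +1 ∷ −1 ∷ +1 ∷ +1 ∷ −1 ∷ +1 ∷ []) ∷
  (−1 ∷ −1 ∷ +1 ∷ −1 ∷ +1 ∷ −1 ∷ +1 ∷ +1 ∷ []) ∷
  (−1 ∷ −1 ∷ +1 ∷ −1 ∷ +1 ∷ −1 ∷ −1 ∷ −1 ∷ []) ∷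
  (−1 ∷ −1 ∷ +1 ∷ −1 ∷ −1 ∷ +1 ∷ +1 ∷ +1 ∷ []) ∷
  (−1 ∷ −1 ∷ +1 ∷ −1 ∷ −1 ∷ +1 ∷ −1 ∷ −1 ∷ []) ∷
  (−1 ∷ −1 ∷ +1 ∷ −1 ∷ −1 ∷ −1 ∷ +1 ∷ −1 ∷ []) ∷
  (−1 ∷ −1 ∷ +1 ∷ −1 ∷ −1 ∷ −1 ∷ −1 ∷ +1 ∷ []) ∷
  (−1 ∷ −1 ∷ −1 ∷ +1 ∷ +1 ∷ +1 ∷ +1 ∷ −1 ∷ []) ∷
  (−1 ∷ −1 ∷ −1 ∷ +1 ∷ +1 ∷ +1 ∷ −1 ∷ +1 ∷ []) ∷
  (−1 ∷ −1 ∷ −1 ∷ +1 ∷ +1 ∷ −1 ∷ +1 ∷ +1 ∷ []) ∷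
  (−1 ∷ −1 ∷ −1 ∷ +1 ∷ +1 ∷ −1 ∷ −1 ∷ −1 ∷ []) ∷
  (−1 ∷ −1 ∷ −1 ∷ +1 ∷ −1 ∷ +1 ∷ +1 ∷ +1 ∷ []) ∷
  (−1 ∷ −1 ∷ −1 ∷ +1 ∷ −1 ∷ +1 ∷ −1 ∷ −1 ∷ []) ∷
  (−1 ∷ −1 ∷ −1 ∷ +1 ∷ −1 ∷ −1 ∷ +1 ∷ −1 ∷ []) ∷
  (−1 ∷ −1 ∷ −1 ∷ +1 ∷ −1 ∷ −1 ∷ −1 ∷ +1 ∷ []) ∷
  (−1 ∷ −1 ∷ −1 ∷ −1 ∷ +1 ∷ +1 ∷ +1 ∷ +1 ∷ []) ∷
  (−1 ∷ −1 ∷ −1 ∷ −1 ∷ +1 ∷ +1 ∷ −1 ∷ −1 ∷ []) ∷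
  (−1 ∷ −1 ∷ −1 ∷ −1 ∷ +1 ∷ −1 ∷ +1 ∷ −1 ∷ []) ∷
  (−1 ∷ −1 ∷ −1 ∷ −1 ∷ +1 ∷ −1 ∷ −1 ∷ +1 ∷ []) ∷
  (−1 ∷ −1 ∷ −1 ∷ −1 ∷ −1 ∷ +1 ∷ +1 ∷ −1 ∷ []) ∷
  (−1 ∷ −1 ∷ −1 ∷ −1 ∷ −1 ∷ +1 ∷ −1 ∷ +1 ∷ []) ∷
  (−1 ∷ −1 ∷ −1 ∷ −1 ∷ −1 ∷ −1 ∷ +1 ∷ +1 ∷ []) ∷
  (−1 ∷ −1 ∷ −1 ∷ −1 ∷ −1 ∷ −1 ∷ −1 ∷ −1 ∷ []) ∷
  []

IsRoot? : (X : V) → Dec (IsRoot X)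
IsRoot? X = ((VecAll.all? (λ z → 2 ℕ.∣? ℤ.∣ z ∣) X ⊎-dec VecAll.all? (λ z → 2 ℕ.∣? ℤ.∣ z - + 1 ∣) X)
              ×-dec (4 ℕ.∣? ℤ.∣ sumV X ∣)) ×-dec (X ⊙ X ℤ.≟ + 8)

all≡true⇒All : ∀ {A : Set} (p : A → Bool) xs → all p xs ≡ true → All.All (T ∘ p) xs
all≡true⇒All p xs all≡true = All.all⁺ p xs (Equivalence.from T-≡ all≡true)

rootCodes-sound : All.All (λ r → IsRoot ⟦ r ⟧ᵥ) rootCodes
rootCodes-sound = All.map (λ {r} → toWitness {a? = IsRoot? ⟦ r ⟧ᵥ}) (all≡true⇒All isRootℤ rootCodes refl)
  where
  isRootℤ : Vec Coord 8 → Bool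
  isRootℤ r = isYes (IsRoot? ⟦ r ⟧ᵥ)

vectorsOver : ∀ {A : Set} → List A → (n : ℕ) → List (Vec A n)
vectorsOver xs zero = [] ∷ []
vectorsOver xs (suc n) = cartesianProductWith _∷_ xs (vectorsOver xs n)

evenCoords oddCoords : List Coord
evenCoords = −2 ∷ 0c ∷ +2 ∷ []
oddCoords = −1 ∷ +1 ∷ []

squares-bounded : ∀ {n c} (X : Vec ℤ n) → X · X ≤ c → VecAll.All (λ z → z * z ≤ c) X
squares-bounded [] _ = VecAll.[]
squares-bounded (x ∷ X) x²+X²≤c =
  ℤ.≤-trans (ℤ.i≤i+j (x * x) (X · X) {{ℤ.nonNegative (·-self-nonneg X)}}) x²+X²≤c VecAll.∷
  squares-bounded X (ℤ.≤-trans (ℤ.i≤j+i (X · X) (x * x) {{ℤ.nonNegative (i*i≥0 x)}}) x²+X²≤c)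

private
  nine≰⟨3+n⟩² : ∀ n → ¬ (suc (suc (suc n)) ℕ.* suc (suc (suc n)) ℕ.≤ 8)
  nine≰⟨3+n⟩² n ≤8 = ℕ.<-irrefl refl (ℕ.≤-trans (ℕ.*-mono-≤ 3≤ 3≤) ≤8)
    where
    3≤ : 3 ℕ.≤ suc (suc (suc n))
    3≤ = s≤s (s≤s (s≤s z≤n))

  ¬2∣1 : ¬ (2 ℕ.∣ 1)
  ¬2∣1 = toWitnessFalse {a? = 2 ℕ.∣? 1} tt

  ¬2∣3 : ¬ (2 ℕ.∣ 3)
  ¬2∣3 = toWitnessFalse {a? = 2 ℕ.∣? 3} tt

even-coordinate : ∀ z → Even z → z * z ≤ + 8 → ∃ λ a → a ∈ evenCoords × ⟦ a ⟧ ≡ z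
even-coordinate (+ 0) _ _ = 0c , there (here refl) , refl
even-coordinate (+ 1) 2∣1 _ = ⊥-elim (¬2∣1 2∣1)
even-coordinate (+ 2) _ _ = +2 , there (there (here refl)) , refl
even-coordinate (+ suc (suc (suc n))) _ (+≤+ ≤8) = ⊥-elim (nine≰⟨3+n⟩² n ≤8)
even-coordinate -[1+ 0 ] 2∣1 _ = ⊥-elim (¬2∣1 2∣1)
even-coordinate -[1+ 1 ] _ _ = −2 , here refl , refl
even-coordinate -[1+ suc (suc n) ] _ (+≤+ ≤8) = ⊥-elim (nine≰⟨3+n⟩² n ≤8)

odd-coordinate : ∀ z → Odd z → z * z ≤ + 8 → ∃ λ a → a ∈ oddCoords × ⟦ a ⟧ ≡ z
odd-coordinate (+ 0) 2∣1 _ = ⊥-elim (¬2∣1 2∣1)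
odd-coordinate (+ 1) _ _ = +1 , there (here refl) , refl
odd-coordinate (+ 2) 2∣1 _ = ⊥-elim (¬2∣1 2∣1)
odd-coordinate (+ suc (suc (suc n))) _ (+≤+ ≤8) = ⊥-elim (nine≰⟨3+n⟩² n ≤8)
odd-coordinate -[1+ 0 ] _ _ = −1 , here refl , refl
odd-coordinate -[1+ 1 ] 2∣3 _ = ⊥-elim (¬2∣3 2∣3)
odd-coordinate -[1+ suc (suc n) ] _ (+≤+ ≤8) = ⊥-elim (nine≰⟨3+n⟩² n ≤8)

coordinates : ∀ {n} {P : ℤ → Set} {cs : List Coord} → (∀ z → P z → z * z ≤ + 8 → ∃ λ a → a ∈ cs × ⟦ a ⟧ ≡ z) →
  {X : Vec ℤ n} → VecAll.All P X → VecAll.All (λ z → z * z ≤ + 8) X → ∃ λ c → c ∈ vectorsOver cs n × ⟦ c ⟧ᵥ ≡ X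
coordinates decodeᶜ {[]} VecAll.[] VecAll.[] = [] , here refl , refl
coordinates decodeᶜ {x ∷ X} (px VecAll.∷ pX) (bx VecAll.∷ bX) with decodeᶜ x px bx | coordinates decodeᶜ pX bX
... | a , a∈ , refl | c , c∈ , refl = a ∷ c , ∈-cartesianProductWith⁺ _∷_ a∈ c∈ , refl

isRootᶜ : Vec Coord 8 → Bool
isRootᶜ c = isYes (c ·ᶜ c ℤ.≟ + 8) ∧ isYes (4 ℕ.∣? ℤ.∣ sumV ⟦ c ⟧ᵥ ∣)

sameAs : Vec Coord 8 → Vec Coord 8 → Bool
sameAs c r = isYes (Vec.≡-dec ℤ._≟_ ⟦ c ⟧ᵥ ⟦ r ⟧ᵥ)

listedIfRoot : Vec Coord 8 → Bool
listedIfRoot c = not (isRootᶜ c) ∨ any (sameAs c) rootCodes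

-- Certificates are stated as b ≡ true and checked by refl; a closed type T b would be
-- reduced by the much slower conversion checker.
even-candidates-listed : all listedIfRoot (vectorsOver evenCoords 8) ≡ true
even-candidates-listed = refl

odd-candidates-listed : all listedIfRoot (vectorsOver oddCoords 8) ≡ true
odd-candidates-listed = refl

private
  T-not : ∀ {b} → T (not b) → ¬ T b
  T-not {false} _ ()

  listed : ∀ {cs} c → all listedIfRoot cs ≡ true → c ∈ cs → IsRoot ⟦ c ⟧ᵥ → ∃ λ r → r ∈ rootCodes × ⟦ c ⟧ᵥ ≡ ⟦ r ⟧ᵥ
  listed {cs} c checked c∈ ((_ , 4∣Σ) , norm≡8)
    with Equivalence.to T-∨ (All.lookup (all≡true⇒All listedIfRoot cs checked) c∈)
  ... | inj₁ ¬isRoot = ⊥-elim (T-not {isRootᶜ c} ¬isRoot (Equivalence.from T-∧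
                         (fromWitness {a? = c ·ᶜ c ℤ.≟ + 8} (trans (sym (·ᶜ-sound c c)) norm≡8) ,
                          fromWitness {a? = 4 ℕ.∣? ℤ.∣ sumV ⟦ c ⟧ᵥ ∣} 4∣Σ)))
  ... | inj₂ isListed = let r , r∈ , same = find (any⁻ (sameAs c) rootCodes isListed) in r , r∈ , toWitness {a? = Vec.≡-dec ℤ._≟_ ⟦ c ⟧ᵥ ⟦ r ⟧ᵥ} same

rootCodes-complete : ∀ {X} → IsRoot X → ∃ λ r → r ∈ rootCodes × X ≡ ⟦ r ⟧ᵥ
rootCodes-complete {X} X-root@((inj₁ even , _) , X·X≡8) =
  let c , c∈ , ⟦c⟧≡X = coordinates even-coordinate even (squares-bounded X (ℤ.≤-reflexive X·X≡8))
      r , r∈ , ⟦c⟧≡⟦r⟧ = listed {vectorsOver evenCoords 8} c even-candidates-listed c∈ (subst IsRoot (sym ⟦c⟧≡X) X-root)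
  in r , r∈ , trans (sym ⟦c⟧≡X) ⟦c⟧≡⟦r⟧
rootCodes-complete {X} X-root@((inj₂ odd , _) , X·X≡8) =
  let c , c∈ , ⟦c⟧≡X = coordinates odd-coordinate odd (squares-bounded X (ℤ.≤-reflexive X·X≡8))
      r , r∈ , ⟦c⟧≡⟦r⟧ = listed {vectorsOver oddCoords 8} c odd-candidates-listed c∈ (subst IsRoot (sym ⟦c⟧≡X) X-root)
  in r , r∈ , trans (sym ⟦c⟧≡X) ⟦c⟧≡⟦r⟧

neighbours : Vec Coord 8 → List (Vec Coord 8)
neighbours x = List.filter (λ u → u ·ᶜ x ℤ.≟ + 4) rootCodes

splitBy : List (Vec Coord 8) → Vec Coord 8 → Vec Coord 8 → Bool
splitBy us x y = not (isYes (x ·ᶜ y ℤ.≟ + 0)) ∨ any (λ u → isYes (u ·ᶜ y ℤ.≟ - (+ 4))) us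

splitsVia : Vec Coord 8 → List (Vec Coord 8) → Bool
splitsVia x us = all (splitBy us x) rootCodes

-- neighbours x is passed as an argument, so that it is evaluated once per x and not once per y
splitsAt : Vec Coord 8 → Bool
splitsAt x = splitsVia x (neighbours x)

rootCodes-split : all splitsAt rootCodes ≡ true
rootCodes-split = refl

private
  splitting : ∀ a b → T (splitBy (neighbours a) a b) → a ·ᶜ b ≡ + 0 →
              ∃ λ u → u ∈ rootCodes × u ·ᶜ a ≡ + 4 × u ·ᶜ b ≡ - (+ 4)
  splitting a b split a·b≡0 with Equivalence.to T-∨ split
  ... | inj₁ a·b≢0 = ⊥-elim (toWitnessFalse {a? = a ·ᶜ b ℤ.≟ + 0} a·b≢0 a·b≡0)
  ... | inj₂ found =
    let u , u∈ , u·b≡-4 = find (any⁻ (λ u → isYes (u ·ᶜ b ℤ.≟ - (+ 4))) (neighbours a) found)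
        u∈roots , u·a≡4 = ∈-filter⁻ (λ u → u ·ᶜ a ℤ.≟ + 4) u∈
    in u , u∈roots , u·a≡4 , toWitness {a? = u ·ᶜ b ℤ.≟ - (+ 4)} u·b≡-4

orthogonal-roots-split : ∀ {X Y} → IsRoot X → IsRoot Y → X ⊙ Y ≡ + 0 →
                         ∃ λ U → IsRoot U × U ⊙ X ≡ + 4 × U ⊙ Y ≡ - (+ 4)
orthogonal-roots-split X-root Y-root X·Y≡0 =
  let a , a∈ , X≡a = rootCodes-complete X-root
      b , b∈ , Y≡b = rootCodes-complete Y-root
      split = All.lookup (all≡true⇒All (splitBy (neighbours a) a) rootCodes (Equivalence.to T-≡ (All.lookup (all≡true⇒All splitsAt rootCodes rootCodes-split) a∈))) b∈
      u , u∈ , u·a≡4 , u·b≡-4 = splitting a b split (trans (sym (·ᶜ-sound a b)) (subst₂ (λ P Q → P ⊙ Q ≡ + 0) X≡a Y≡b X·Y≡0))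
  in ⟦ u ⟧ᵥ , All.lookup rootCodes-sound u∈
   , trans (cong (⟦ u ⟧ᵥ ⊙_) X≡a) (trans (·ᶜ-sound u a) u·a≡4)
   , trans (cong (⟦ u ⟧ᵥ ⊙_) Y≡b) (trans (·ᶜ-sound u b) u·b≡-4)

-- Reflections preserving the cross-polytope

2∣a+a′⇒2∣b+b′⇒2∣ab+a′b′ : ∀ {a a′ b b′} → + 2 ∣ a + a′ → + 2 ∣ b + b′ → + 2 ∣ a * b + a′ * b′
2∣a+a′⇒2∣b+b′⇒2∣ab+a′b′ {a} {a′} {b} {b′} 2∣a+a′ 2∣b+b′ =
  subst (+ 2 ∣_) (ring a a′ b b′)
    (∣m∣n⇒∣m+n (∣m∣n⇒∣m-n (∣m∣n⇒∣m-n (∣n⇒∣m*n (a * b) (divides (+ 1) refl)) (∣n⇒∣m*n a 2∣b+b′)) (∣n⇒∣m*n b 2∣a+a′))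
               (∣n⇒∣m*n (a + a′) 2∣b+b′))
  where
  ring : ∀ a a′ b b′ → a * b * + 2 - a * (b + b′) - b * (a + a′) + (a + a′) * (b + b′) ≡ a * b + a′ * b′
  ring = solve-∀

reflect-8∣ : ∀ {x z k} → + 8 ∣ z ⊙ k → + 8 ∣ x ⊙ k → + 8 ∣ reflect x z ⊙ k
reflect-8∣ {x} {z} {k} 8∣z·k 8∣x·k = subst (+ 8 ∣_) (sym (reflect-· x z k)) (∣m∣n⇒∣m-n 8∣z·k (∣n⇒∣m*n (z ⊙ x / + 4) 8∣x·k))

reflect-pair-· : ∀ p q z k → q ⊙ p ≡ + 0 →
  reflect p (reflect q z) ⊙ k ≡ z ⊙ k - (z ⊙ q / + 4) * (q ⊙ k) - (z ⊙ p / + 4) * (p ⊙ k)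
reflect-pair-· p q z k q·p≡0 = begin
  reflect p (reflect q z) ⊙ k                                            ≡⟨ reflect-· p (reflect q z) k ⟩
  reflect q z ⊙ k - (reflect q z ⊙ p / + 4) * (p ⊙ k)                    ≡⟨ cong₂ (λ a b → a - (b / + 4) * (p ⊙ k)) (reflect-· q z k) (reflect-⊥ q z p q·p≡0) ⟩
  z ⊙ k - (z ⊙ q / + 4) * (q ⊙ k) - (z ⊙ p / + 4) * (p ⊙ k)              ∎
  where open ≡-Reasoning

-- The two correction terms are 4 α β and 4 α′ β′ with α ≡ α′ and β ≡ β′ (mod 2).
reflect-pair-8∣ : ∀ {x y p q z k : V} → q ⊙ p ≡ + 0 → (∀ w → w ⊙ p + w ⊙ q ≡ w ⊙ x - w ⊙ y) →
  + 4 ∣ z ⊙ p → + 4 ∣ z ⊙ q → + 4 ∣ k ⊙ p → + 4 ∣ k ⊙ q →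
  + 8 ∣ z ⊙ k → + 8 ∣ z ⊙ x - z ⊙ y → + 8 ∣ k ⊙ x - k ⊙ y → + 8 ∣ reflect p (reflect q z) ⊙ k
reflect-pair-8∣ {x} {y} {p} {q} {z} {k} q·p≡0 sum 4∣z·p 4∣z·q 4∣k·p 4∣k·q 8∣z·k 8∣z·x-z·y 8∣k·x-k·y =
  subst (+ 8 ∣_) (sym expand)
    (∣m∣n⇒∣m-n 8∣z·k (*-monoˡ-∣ (+ 4) (2∣a+a′⇒2∣b+b′⇒2∣ab+a′b′ {α} {α′} {β} {β′}
      (half 4∣z·q 4∣z·p 8∣z·x-z·y (sum z)) (half 4∣k·q 4∣k·p 8∣k·x-k·y (sum k)))))
  where
  α α′ β β′ : ℤ
  α = z ⊙ q / + 4
  α′ = z ⊙ p / + 4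
  β = k ⊙ q / + 4
  β′ = k ⊙ p / + 4
  half : ∀ {a b c} → + 4 ∣ a → + 4 ∣ b → + 8 ∣ c → b + a ≡ c → + 2 ∣ a / + 4 + b / + 4
  half {a} {b} {c} 4∣a 4∣b 8∣c b+a≡c = *-cancelʳ-∣ (+ 4) (subst (+ 8 ∣_) c≡ 8∣c)
    where
    c≡ : c ≡ (a / + 4 + b / + 4) * + 4
    c≡ = begin
      c                                  ≡⟨ sym b+a≡c ⟩
      b + a                              ≡⟨ ℤ.+-comm b a ⟩
      a + b                              ≡⟨ cong₂ _+_ (sym ([a/n]*n≡a 4∣a)) (sym ([a/n]*n≡a 4∣b)) ⟩
      a / + 4 * + 4 + b / + 4 * + 4      ≡⟨ sym (ℤ.*-distribʳ-+ (+ 4) (a / + 4) (b / + 4)) ⟩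
      (a / + 4 + b / + 4) * + 4          ∎
      where open ≡-Reasoning
  expand : reflect p (reflect q z) ⊙ k ≡ z ⊙ k - (α * β + α′ * β′) * + 4
  expand = begin
    reflect p (reflect q z) ⊙ k                      ≡⟨ reflect-pair-· p q z k q·p≡0 ⟩
    z ⊙ k - α * (q ⊙ k) - α′ * (p ⊙ k)              ≡⟨ cong₂ (λ s t → z ⊙ k - α * s - α′ * t) (·-comm q k) (·-comm p k) ⟩
    z ⊙ k - α * (k ⊙ q) - α′ * (k ⊙ p)              ≡⟨ cong₂ (λ s t → z ⊙ k - α * s - α′ * t) (sym ([a/n]*n≡a 4∣k·q)) (sym ([a/n]*n≡a 4∣k·p)) ⟩
    z ⊙ k - α * (β * + 4) - α′ * (β′ * + 4)          ≡⟨ ring (z ⊙ k) α α′ β β′ ⟩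
    z ⊙ k - (α * β + α′ * β′) * + 4                  ∎
    where
    open ≡-Reasoning
    ring : ∀ c a a′ b b′ → c - a * (b * + 4) - a′ * (b′ * + 4) ≡ c - (a * b + a′ * b′) * + 4
    ring = solve-∀

module Complement {x y p : V} (x-root : IsRoot x) (y-root : IsRoot y) (p-root : IsRoot p)
         (x·y≡0 : x ⊙ y ≡ + 0) (p·x≡4 : p ⊙ x ≡ + 4) (p·y≡-4 : p ⊙ y ≡ - (+ 4)) where

  q : V
  q = (x -ᵥ y) -ᵥ p

  complement-· : ∀ w → w ⊙ p + w ⊙ q ≡ w ⊙ x - w ⊙ y
  complement-· w = begin
    w ⊙ p + w ⊙ q                    ≡⟨ cong (λ t → w ⊙ p + t) (·-distribˡ--ᵥ w (x -ᵥ y) p) ⟩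
    w ⊙ p + (w ⊙ (x -ᵥ y) - w ⊙ p)  ≡⟨ cong (λ t → w ⊙ p + (t - w ⊙ p)) (·-distribˡ--ᵥ w x y) ⟩
    w ⊙ p + (w ⊙ x - w ⊙ y - w ⊙ p) ≡⟨ ring (w ⊙ p) (w ⊙ x) (w ⊙ y) ⟩
    w ⊙ x - w ⊙ y                    ∎
    where
    open ≡-Reasoning
    ring : ∀ a b c → a + (b - c - a) ≡ b - c
    ring = solve-∀

  complement-⊥ : q ⊙ p ≡ + 0
  complement-⊥ = begin
    q ⊙ p                  ≡⟨ ·-comm q p ⟩
    p ⊙ q                  ≡⟨ ·-distribˡ--ᵥ p (x -ᵥ y) p ⟩
    p ⊙ (x -ᵥ y) - p ⊙ p   ≡⟨ cong₂ (λ a b → a - b) (·-distribˡ--ᵥ p x y) (proj₂ p-root) ⟩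
    p ⊙ x - p ⊙ y - + 8    ≡⟨ cong₂ (λ a b → a - b - + 8) p·x≡4 p·y≡-4 ⟩
    + 0                    ∎
    where open ≡-Reasoning

  complement-root : IsRoot q
  complement-root = Λ--ᵥ (Λ--ᵥ (proj₁ x-root) (proj₁ y-root)) (proj₁ p-root) , (begin
    q ⊙ q                                                            ≡⟨ -ᵥ-norm (x -ᵥ y) p ⟩
    (x -ᵥ y) ⊙ (x -ᵥ y) - + 2 * ((x -ᵥ y) ⊙ p) + p ⊙ p               ≡⟨ cong₂ (λ a b → a - + 2 * b + p ⊙ p) (-ᵥ-norm x y) (·-distribʳ--ᵥ x y p) ⟩
    (x ⊙ x - + 2 * (x ⊙ y) + y ⊙ y) - + 2 * (x ⊙ p - y ⊙ p) + p ⊙ p  ≡⟨ cong₂ (λ a b → (x ⊙ x - + 2 * (x ⊙ y) + y ⊙ y) - + 2 * (a - b) + p ⊙ p) (·-comm x p) (·-comm y p) ⟩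
    (x ⊙ x - + 2 * (x ⊙ y) + y ⊙ y) - + 2 * (p ⊙ x - p ⊙ y) + p ⊙ p  ≡⟨ cong₂ (λ a b → (a - + 2 * (x ⊙ y) + b) - + 2 * (p ⊙ x - p ⊙ y) + p ⊙ p) (proj₂ x-root) (proj₂ y-root) ⟩
    (+ 8 - + 2 * (x ⊙ y) + + 8) - + 2 * (p ⊙ x - p ⊙ y) + p ⊙ p      ≡⟨ cong₂ (λ a b → (+ 8 - + 2 * a + + 8) - + 2 * b + p ⊙ p) x·y≡0 (cong₂ _-_ p·x≡4 p·y≡-4) ⟩
    (+ 8 - + 2 * + 0 + + 8) - + 2 * (+ 4 - - (+ 4)) + p ⊙ p          ≡⟨ cong (λ a → (+ 8 - + 2 * + 0 + + 8) - + 2 * (+ 4 - - (+ 4)) + a) (proj₂ p-root) ⟩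
    + 8                                                              ∎)
    where open ≡-Reasoning

  complement-sends : reflect p (reflect q x) ≡ y
  complement-sends = begin
    reflect p (reflect q x)                         ≡⟨ cong (λ t → reflect q x -ᵥ (t / + 4) *ᵥ p) (trans (reflect-⊥ q x p complement-⊥) x·p≡4) ⟩
    reflect q x -ᵥ + 1 *ᵥ p                         ≡⟨ cong (λ t → (x -ᵥ (t / + 4) *ᵥ q) -ᵥ + 1 *ᵥ p) x·q≡4 ⟩
    (x -ᵥ + 1 *ᵥ q) -ᵥ + 1 *ᵥ p                     ≡⟨ cancel x y p ⟩
    y                                               ∎
    where
    open ≡-Reasoning
    x·p≡4 : x ⊙ p ≡ + 4
    x·p≡4 = trans (·-comm x p) p·x≡4
    x·q≡4 : x ⊙ q ≡ + 4
    x·q≡4 = begin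
      x ⊙ q                  ≡⟨ ·-distribˡ--ᵥ x (x -ᵥ y) p ⟩
      x ⊙ (x -ᵥ y) - x ⊙ p   ≡⟨ cong₂ _-_ (·-distribˡ--ᵥ x x y) x·p≡4 ⟩
      x ⊙ x - x ⊙ y - + 4    ≡⟨ cong₂ (λ a b → a - b - + 4) (proj₂ x-root) x·y≡0 ⟩
      + 4                    ∎
    cancel : ∀ {n} (X Y P : Vec ℤ n) → (X -ᵥ + 1 *ᵥ ((X -ᵥ Y) -ᵥ P)) -ᵥ + 1 *ᵥ P ≡ Y
    cancel [] [] [] = refl
    cancel (x ∷ X) (y ∷ Y) (p ∷ P) = cong₂ _∷_ (ring x y p) (cancel X Y P)
      where
      ring : ∀ x y p → (x - + 1 * ((x - y) - p)) - + 1 * p ≡ y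
      ring = solve-∀

-- Stabilisers of a 16-clique

module Clique (K : Fin 16 → V) (K-clique : IsClique16 K) where

  K-root : ∀ m → IsRoot (K m)
  K-root = proj₁ K-clique

  K-norm : ∀ m → K m ⊙ K m ≡ + 8
  K-norm m = proj₂ (K-root m)

  open CrossPolytope K K-norm (proj₂ (proj₂ K-clique)) (proj₁ (proj₂ K-clique)) using (∈-crossPolytope)

  8∣K·K : ∀ m n → + 8 ∣ K m ⊙ K n
  8∣K·K m n with m Fin.≟ n
  ... | yes refl = divides (+ 1) (K-norm m)
  ... | no m≢n with proj₂ (proj₂ K-clique) m n m≢n
  ...   | inj₁ K·K≡-8 = divides (- (+ 1)) K·K≡-8
  ...   | inj₂ K·K≡0 = divides (+ 0) K·K≡0

  4∣K·root : ∀ {X} → IsRoot X → ∀ m → + 4 ∣ K m ⊙ X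
  4∣K·root X-root m = Λ-integral (proj₁ (K-root m)) (proj₁ X-root)

  MapsIntoK : (V → V) → Set
  MapsIntoK f = ∀ m → ∃ λ n → f (K m) ≡ K n

  maps-into-K : (f : V → V) → (∀ m → f (K m) ⊙ f (K m) ≡ + 8) → (∀ m n → + 8 ∣ f (K m) ⊙ K n) → MapsIntoK f
  maps-into-K f f-norm 8∣f·K m = ∈-crossPolytope (f (K m)) (f-norm m) (8∣f·K m)

  stabilizes : (w : WeylWord) (g : V → V) → MapsIntoK (act w) → MapsIntoK g → (∀ n → act w (g (K n)) ≡ K n) → Stabilizes w K
  stabilizes w g w-into g-into w∘g≡id = w-into , λ n → let m , g[Kn]≡Km = g-into n in m , trans (cong (act w) (sym g[Kn]≡Km)) (w∘g≡id n)

  reflection-stabilizes : ∀ i → Stabilizes (word (K i ∷ []) (K-root i All.∷ All.[])) K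
  reflection-stabilizes i = stabilizes (word (K i ∷ []) (K-root i All.∷ All.[])) (reflect (K i)) into into
                            (λ n → reflect-involutive (K i) (K n) (K-norm i) (4∣K·root (K-root i) n))
    where
    into : MapsIntoK (reflect (K i))
    into = maps-into-K (reflect (K i))
      (λ m → trans (reflect-norm (K i) (K m) (K-norm i) (4∣K·root (K-root i) m)) (K-norm m))
      (λ m n → reflect-8∣ {K i} {K m} {K n} (8∣K·K m n) (8∣K·K i n))

  module _ {i j : Fin 16} where

    private
      pair-into : ∀ {p q} → IsRoot p → IsRoot q → q ⊙ p ≡ + 0 → (∀ w → w ⊙ p + w ⊙ q ≡ w ⊙ K i - w ⊙ K j) →
                  MapsIntoK (reflect p ∘ reflect q)
      pair-into {p} {q} p-root q-root q·p≡0 sum = maps-into-K (reflect p ∘ reflect q) norm 8∣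
        where
        norm : ∀ m → reflect p (reflect q (K m)) ⊙ reflect p (reflect q (K m)) ≡ + 8
        norm m = trans (reflect-norm p (reflect q (K m)) (proj₂ p-root) (subst (+ 4 ∣_) (sym (reflect-⊥ q (K m) p q·p≡0)) (4∣K·root p-root m)))
                       (trans (reflect-norm q (K m) (proj₂ q-root) (4∣K·root q-root m)) (K-norm m))
        8∣ : ∀ m n → + 8 ∣ reflect p (reflect q (K m)) ⊙ K n
        8∣ m n = reflect-pair-8∣ {K i} {K j} {p} {q} {K m} {K n} q·p≡0 sum (4∣K·root p-root m) (4∣K·root q-root m) (4∣K·root p-root n) (4∣K·root q-root n)
                   (8∣K·K m n) (∣m∣n⇒∣m-n (8∣K·K m i) (8∣K·K m j)) (∣m∣n⇒∣m-n (8∣K·K n i) (8∣K·K n j))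

    reflection-pair-stabilizes : ∀ {p q} (p-root : IsRoot p) (q-root : IsRoot q) → q ⊙ p ≡ + 0 →
      (∀ w → w ⊙ p + w ⊙ q ≡ w ⊙ K i - w ⊙ K j) → Stabilizes (word (p ∷ q ∷ []) (p-root All.∷ q-root All.∷ All.[])) K
    reflection-pair-stabilizes {p} {q} p-root q-root q·p≡0 sum =
      stabilizes (word (p ∷ q ∷ []) (p-root All.∷ q-root All.∷ All.[])) (reflect q ∘ reflect p)
        (pair-into p-root q-root q·p≡0 sum)
        (pair-into q-root p-root p·q≡0 (λ w → trans (ℤ.+-comm (w ⊙ q) (w ⊙ p)) (sum w)))
        (λ n → trans (cong (reflect p) (reflect-involutive q (reflect p (K n)) (proj₂ q-root)
                                         (subst (+ 4 ∣_) (sym (reflect-⊥ p (K n) q p·q≡0)) (4∣K·root q-root n))))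
                     (reflect-involutive p (K n) (proj₂ p-root) (4∣K·root p-root n)))
      where
      p·q≡0 : p ⊙ q ≡ + 0
      p·q≡0 = trans (·-comm p q) q·p≡0

  orthogonal-transitive : ∀ i j → K i ⊙ K j ≡ + 0 → ∃ λ (w : WeylWord) → Stabilizes w K × act w (K i) ≡ K j
  orthogonal-transitive i j x·y≡0 = via (orthogonal-roots-split (K-root i) (K-root j) x·y≡0)
    where
    via : (∃ λ p → IsRoot p × p ⊙ K i ≡ + 4 × p ⊙ K j ≡ - (+ 4)) → ∃ λ (w : WeylWord) → Stabilizes w K × act w (K i) ≡ K j
    via (p , p-root , p·x≡4 , p·y≡-4) =
      word (p ∷ q ∷ []) (p-root All.∷ complement-root All.∷ All.[]) ,
      reflection-pair-stabilizes p-root complement-root complement-⊥ complement-· ,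
      complement-sends
      where open Complement (K-root i) (K-root j) p-root x·y≡0 p·x≡4 p·y≡-4

  transitive : ∀ i j → ∃ λ (w : WeylWord) → Stabilizes w K × act w (K i) ≡ K j
  transitive i j with i Fin.≟ j
  ... | yes refl = word [] All.[] , ((λ m → m , refl) , (λ n → n , refl)) , refl
  ... | no i≢j with proj₂ (proj₂ K-clique) i j i≢j
  ...   | inj₁ x·y≡-8 = word (K i ∷ []) (K-root i All.∷ All.[]) , reflection-stabilizes i ,
                        trans (reflect-self (K-norm i)) (sym (·≡-norm⇒≡-ᵥ (K-norm i) (K-norm j) x·y≡-8))
  ...   | inj₂ x·y≡0 = orthogonal-transitive i j x·y≡0

corollary5p10 : (K : Fin 16 → Vec ℤ 8) → IsClique16 K →
    ∀ i j → ∃ λ (w : WeylWord) → Stabilizes w K × act w (K i) ≡ K j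
corollary5p10 = Clique.transitive
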